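{- There exist an infinite sequence of integers $n$, matrices $M_n \in \{0,1\}^{m \times n}$ (with $m = m(n)$) each of whose columns has Hamming weight at most $3$, submatrices $A_n$ of $M_n$, and a constant $c > 0$, such that for every $n$ in the sequence: 1. there is a valid set of choices (i.e. a resolution of ties among lightest rows) for which the algorithm (P)ESS-FINDER run on $M_n$ outputs $A_n$; 2. $\dim_{\mathbb{F}_2}(\ker M_n) \le n/2 + 2$; 3. $\dim_{\mathbb{F}_2}(\ker A_n) \ge n/2 + c\,n$.
   Context: All matrices are over $\mathbb{F}_2$; $\ker M = \{x \in \mathbb{F}_2^n : Mx = 0\}$. For row index set $C \subseteq [m]$ and column index set $V \subseteq [n]$, $M(C,V)$ denotes the submatrix of $M$ with rows $C$ and columns $V$. The weight of a row or column is its number of ones. Procedure STRIP, applied to a submatrix $M(C,V)$: while the current submatrix has a column $x \in V$ of weight exactly $1$, remove the column $x$ from $V$ and remove from $C$ the row containing its unique $1$; when no such column remains, return the current submatrix (possibly empty). Algorithm (P)ESS-FINDER, with input a matrix $M \in \{0,1\}^{m \times n}$ in which every column has weight at most $3$: (1) Set $H \leftarrow M$, $C \leftarrow \emptyset$, $V \leftarrow \emptyset$. (2) While $C \ne [m]$ and $V \ne [n]$: (a) choose a row $c \notin C$ whose weight in the current matrix $H$ is minimal (a "lightest row"; when several rows are lightest, any of them may be chosen, and each such choice is a valid choice); let $V_c$ be the set of columns $j$ with $H(c,j)=1$; add $c$ to $C$, add $V_c$ to $V$, and set all entries of the columns $V_c$ of $H$ to zero. (b) If $V_c = \emptyset$ and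 STRIP$(M(C,V)) \ne \emptyset$, output STRIP$(M(C,V))$ and halt. (3) Return $M(C,V)$. -}

module Defs where

open import Data.Bool using (Bool; true; false; _∧_; _xor_; not)
open import Data.Nat using (ℕ; zero; suc; _≤_)
open import Data.Fin using (Fin; zero; suc)
open import Data.Fin.Subset using (Subset; _∈_; _∉_; ⊤; ⊥; _∪_; _-_; ⁅_⁆; ∣_∣; _∩_; Nonempty; Empty)
open import Data.Vec using (tabulate; lookup)
open import Relation.Nullary using (¬_)
open import Data.Product using (Σ; ∃; _×_; _,_)
open import Data.Sum using (_⊎_)
open import Relation.Binary.PropositionalEquality using (_≡_; _≢_)

-- Matrices over F₂ = Bool (true = 1, xor = +, ∧ = ·)

Matrix : ℕ → ℕ → Set
Matrix m n = Fin m → Fin n → Bool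

sumF2 : ∀ {n} → (Fin n → Bool) → Bool
sumF2 {zero}  f = false
sumF2 {suc n} f = f zero xor sumF2 (λ i → f (suc i))

weight : ∀ {n} → (Fin n → Bool) → ℕ
weight f = ∣ tabulate f ∣

ColWeightAtMost3 : ∀ {m n} → Matrix m n → Set
ColWeightAtMost3 {m} {n} M = ∀ (j : Fin n) → weight (λ r → M r j) ≤ 3

-- Kernel of the submatrix M(C,V), with x ∈ F₂^V viewed as a vector of
-- F₂^n vanishing outside V (canonical identification).

InKer : ∀ {m n} → Matrix m n → Subset m → Subset n → (Fin n → Bool) → Set
InKer M C V x =
  (∀ j → j ∉ V → x j ≡ false) ×
  (∀ r → r ∈ C → sumF2 (λ j → M r j ∧ x j) ≡ false)

lincomb : ∀ {d n} → (Fin d → Bool) → (Fin d → Fin n → Bool) → Fin n → Bool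
lincomb a b j = sumF2 (λ i → a i ∧ b i j)

LinIndep : ∀ {d n} → (Fin d → Fin n → Bool) → Set
LinIndep {d} {n} b =
  ∀ (a : Fin d → Bool) → (∀ j → lincomb a b j ≡ false) → ∀ i → a i ≡ false

KerDim : ∀ {m n} → Matrix m n → Subset m → Subset n → ℕ → Set
KerDim {m} {n} M C V d =
  Σ (Fin d → Fin n → Bool) λ b →
    (∀ i → InKer M C V (b i)) ×
    LinIndep b ×
    (∀ x → InKer M C V x → ∃ λ (a : Fin d → Bool) → ∀ j → x j ≡ lincomb a b j)

-- STRIP, as a relation: StripRun M (C , V) (C' , V') means that some run
-- of STRIP on M(C,V) returns M(C',V').

colWeightIn : ∀ {m n} → Matrix m n → Subset m → Fin n → ℕ
colWeightIn M C x = ∣ C ∩ tabulate (λ r → M r x) ∣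

data StripRun {m n} (M : Matrix m n) :
       Subset m → Subset n → Subset m → Subset n → Set where
  done : ∀ {C V} →
         (∀ x → x ∈ V → colWeightIn M C x ≢ 1) →
         StripRun M C V C V
  step : ∀ {C V C' V'} (x : Fin n) (r : Fin m) →
         x ∈ V → colWeightIn M C x ≡ 1 → r ∈ C → M r x ≡ true →
         StripRun M (C - r) (V - x) C' V' →
         StripRun M C V C' V'

EmptySub : ∀ {m n} → Subset m → Subset n → Set
EmptySub C V = Empty C ⊎ Empty V

-- (P)ESS-FINDER, as a relation: Finder M H C V C' V' means that some
-- valid execution of the loop (2) started from state (H, C, V)
-- produces output M(C',V').

Lightest : ∀ {m n} → Matrix m n → Subset m → Fin m → Set
Lightest H C c = c ∉ C × (∀ c' → c' ∉ C → weight (H c) ≤ weight (H c'))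

rowSupport : ∀ {m n} → Matrix m n → Fin m → Subset n
rowSupport H c = tabulate (H c)

zeroCols : ∀ {m n} → Matrix m n → Subset n → Matrix m n
zeroCols H Vc r j = H r j ∧ not (lookup Vc j)

data Finder {m n} (M : Matrix m n) :
       Matrix m n → Subset m → Subset n → Subset m → Subset n → Set where
  return : ∀ {H C V} → (C ≡ ⊤ ⊎ V ≡ ⊤) → Finder M H C V C V
  halt : ∀ {H C V C' V'} (c : Fin m) →
         C ≢ ⊤ → V ≢ ⊤ → Lightest H C c →
         Empty (rowSupport H c) →
         StripRun M (C ∪ ⁅ c ⁆) (V ∪ rowSupport H c) C' V' →
         ¬ EmptySub C' V' →
         Finder M H C V C' V'
  continue : ∀ {H C V C' V'} (c : Fin m) →
         C ≢ ⊤ → V ≢ ⊤ → Lightest H C c →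
         (Nonempty (rowSupport H c) ⊎
           (∃ λ C₀ → ∃ λ V₀ →
              StripRun M (C ∪ ⁅ c ⁆) (V ∪ rowSupport H c) C₀ V₀ × EmptySub C₀ V₀)) →
         Finder M (zeroCols H (rowSupport H c)) (C ∪ ⁅ c ⁆) (V ∪ rowSupport H c) C' V' →
         Finder M H C V C' V'

module Submission where

-- The matrix has K = 3k rows A_i of weight 3 on their own columns, a chain of S = K + 2
-- rows D_j of weight 3, each sharing a column with its predecessor (D_0 with A_{K-1}),
-- a row T equal to D_{K+1}, and 3k rows B tying the first K chain columns together in
-- triples through 2k further columns.  Choosing A_0, …, A_{K-1} and then D_0, …, D_{K+1}
-- is a valid run: every unchosen row stays at least as heavy as the chosen one (3, resp.
-- 2).  Then T has weight 0 and the algorithm halts; STRIP peels A_i and D_j (j ≤ K) at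
-- their private columns, leaving the two equal rows D_{K+1}, T on 9k + 3 columns, so
-- dim ker A = 9k + 2.  In M itself T is the only dependency: peeling every other row
-- shows rank M = 9k + 2, so dim ker M = n − (9k + 2) = 8k + 2 where n = 17k + 4.

open import Defs
open import Algebra.Bundles using (CommutativeRing)
open import Data.Bool.Base using (Bool; true; false; _∧_; _∨_; _xor_; not; if_then_else_)
open import Data.Bool.Properties
  using (xor-∧-commutativeRing; xor-same; xor-identityʳ; xor-assoc; ∧-distribˡ-xor;
         ∧-zeroʳ; ∧-identityʳ; ∨-zeroʳ; ∨-identityʳ; ¬-not)
open import Data.Empty as Empty using (⊥-elim)
open import Data.Sum using (_⊎_; inj₁; inj₂)
open import Data.Fin.Base using (Fin; zero; suc; toℕ; fromℕ<)
open import Data.Fin.Properties using (punchInᵢ≢i; toℕ-fromℕ<; fromℕ<-toℕ; toℕ<n) renaming (_≟_ to _≟ᶠ_)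
open import Data.Fin.Subset
  using (Subset; _∈_; _∉_; _-_; _∪_; _∩_; ⁅_⁆; ⊤; ⊥; ∣_∣; Nonempty; Empty; inside; outside)
open import Data.Fin.Subset.Properties
  using (∈⊤; ∣⊤∣≡n; x∈⁅x⁆; x∈⁅y⁆⇒x≡y; x≢y⇒x∉⁅y⁆; x∈p∪q⁺; x∈p∪q⁻; x∈p∩q⁺; x∈p∩q⁻;
         x∈p∧x≢y⇒x∈p-y; p─q⊆p; p─⊥≡p; _∈?_)
open import Data.Vec.Base using (_∷_; here; there; lookup; tabulate)
open import Data.Vec.Properties
  using (lookup∘tabulate; []=⇒lookup; lookup⇒[]=; lookup-zipWith; lookup-replicate)
open import Data.List.Base using (List; []; _∷_; length; map)
open import Data.List.Properties using (length-map)
open import Data.List.Membership.Propositional.Properties using (∈-map⁺)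
open import Data.List.Membership.Propositional using () renaming (_∈_ to _∈ˡ_)
open import Data.List.Relation.Unary.All as All using (All; []; _∷_)
open import Data.List.Relation.Unary.Any using (here; there)
open import Data.List.Relation.Unary.Unique.Propositional using (Unique; []; _∷_)
open import Data.Nat.Base using (ℕ; zero; suc; _+_; _*_; _∸_; _≤_; _<_; z≤n; s≤s; _<ᵇ_; _≡ᵇ_)
import Data.Nat as ℕ
open import Data.Nat.Properties hiding (_≟_)
open import Data.Nat.Tactic.RingSolver using (solve-∀)
open import Data.Product using (Σ; ∃; _×_; _,_; proj₁; proj₂)
open import Data.Vec.Functional using (updateAt; removeAt)
open import Data.Vec.Functional.Properties using (updateAt-updates; updateAt-minimal)
open import Function.Base using (_∘_; const)
open import Relation.Binary.PropositionalEquality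
  using (_≡_; _≢_; _≗_; refl; sym; trans; cong; cong₂; subst; subst₂; module ≡-Reasoning)
open import Relation.Nullary using (Dec; yes; no; ¬_)
open import Relation.Nullary.Decidable using (⌊_⌋)

private module F₂ = CommutativeRing xor-∧-commutativeRing
open import Algebra.Properties.Semiring.Sum F₂.semiring
  using (sum; sum-cong-≗; sum-replicate-zero; sum-remove; ∑-distrib-+; ∑-comm; *-distribˡ-sum)

sumF2≡sum : ∀ {n} (f : Fin n → Bool) → sumF2 f ≡ sum f
sumF2≡sum {zero}  f = refl
sumF2≡sum {suc n} f = cong (f zero xor_) (sumF2≡sum (f ∘ suc))

sumF2-cong : ∀ {n} {f g : Fin n → Bool} → f ≗ g → sumF2 f ≡ sumF2 g
sumF2-cong {f = f} {g} f≗g = trans (sumF2≡sum f) (trans (sum-cong-≗ f≗g) (sym (sumF2≡sum g)))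

sumF2-zero : ∀ {n} {f : Fin n → Bool} → (∀ i → f i ≡ false) → sumF2 f ≡ false
sumF2-zero {n} {f} f≡0 = trans (sumF2≡sum f) (trans (sum-cong-≗ f≡0) (sum-replicate-zero n))

sumF2-xor : ∀ {n} (f g : Fin n → Bool) → sumF2 (λ i → f i xor g i) ≡ sumF2 f xor sumF2 g
sumF2-xor f g = begin
  sumF2 (λ i → f i xor g i) ≡⟨ sumF2≡sum (λ i → f i xor g i) ⟩
  sum (λ i → f i xor g i)   ≡⟨ ∑-distrib-+ f g ⟩
  sum f xor sum g           ≡⟨ sym (cong₂ _xor_ (sumF2≡sum f) (sumF2≡sum g)) ⟩
  sumF2 f xor sumF2 g       ∎
  where open ≡-Reasoning

∧-distribˡ-sumF2 : ∀ {n} c (f : Fin n → Bool) → c ∧ sumF2 f ≡ sumF2 (λ i → c ∧ f i)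
∧-distribˡ-sumF2 c f = begin
  c ∧ sumF2 f           ≡⟨ cong (c ∧_) (sumF2≡sum f) ⟩
  c ∧ sum f             ≡⟨ *-distribˡ-sum c f ⟩
  sum (λ i → c ∧ f i)   ≡⟨ sym (sumF2≡sum (λ i → c ∧ f i)) ⟩
  sumF2 (λ i → c ∧ f i) ∎
  where open ≡-Reasoning

sumF2-comm : ∀ {m n} (g : Fin m → Fin n → Bool) →
  sumF2 (λ i → sumF2 (g i)) ≡ sumF2 (λ j → sumF2 (λ i → g i j))
sumF2-comm g = begin
  sumF2 (λ i → sumF2 (g i))           ≡⟨ sumF2-cong (λ i → sumF2≡sum (g i)) ⟩
  sumF2 (λ i → sum (g i))             ≡⟨ sumF2≡sum (λ i → sum (g i)) ⟩
  sum (λ i → sum (g i))               ≡⟨ ∑-comm g ⟩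
  sum (λ j → sum (λ i → g i j))       ≡⟨ sym (sumF2≡sum (λ j → sum (λ i → g i j))) ⟩
  sumF2 (λ j → sum (λ i → g i j))     ≡⟨ sym (sumF2-cong (λ j → sumF2≡sum (λ i → g i j))) ⟩
  sumF2 (λ j → sumF2 (λ i → g i j))   ∎
  where open ≡-Reasoning

sumF2-supported : ∀ {n} (f : Fin n → Bool) i → (∀ j → j ≢ i → f j ≡ false) → sumF2 f ≡ f i
sumF2-supported {suc n} f i f≡0 = begin
  sumF2 f                        ≡⟨ sumF2≡sum f ⟩
  sum f                          ≡⟨ sum-remove {i = i} f ⟩
  f i xor sum (removeAt f i)     ≡⟨ cong (f i xor_) (sym (sumF2≡sum (removeAt f i))) ⟩
  f i xor sumF2 (removeAt f i)   ≡⟨ cong (f i xor_) (sumF2-zero (λ j → f≡0 _ (punchInᵢ≢i i j))) ⟩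
  f i xor false                  ≡⟨ xor-identityʳ (f i) ⟩
  f i                            ∎
  where open ≡-Reasoning

x∉p-x : ∀ {n} (p : Subset n) x → x ∉ p - x
x∉p-x (s ∷ p) zero    ()
x∉p-x (s ∷ p) (suc x) (there x∈p-x) = x∉p-x p x x∈p-x

x∈p-y⇒x≢y : ∀ {n} {p : Subset n} {x y} → x ∈ p - y → x ≢ y
x∈p-y⇒x≢y {p = p} {x} x∈p-y refl = x∉p-x p x x∈p-y

x∈p-y⇒x∈p : ∀ {n} {p : Subset n} {x y} → x ∈ p - y → x ∈ p
x∈p-y⇒x∈p {p = p} = p─q⊆p p _

∣p∣≡1+∣p-x∣ : ∀ {n} {p : Subset n} {x} → x ∈ p → ∣ p ∣ ≡ suc ∣ p - x ∣
∣p∣≡1+∣p-x∣ {p = inside  ∷ p} {zero}  here       = cong (suc ∘ ∣_∣) (sym (p─⊥≡p p))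
∣p∣≡1+∣p-x∣ {p = inside  ∷ p} {suc x} (there x∈p) = cong suc (∣p∣≡1+∣p-x∣ x∈p)
∣p∣≡1+∣p-x∣ {p = outside ∷ p} {suc x} (there x∈p) = ∣p∣≡1+∣p-x∣ x∈p

∣p∣≡1+k⇒nonempty : ∀ {n} (p : Subset n) {k} → ∣ p ∣ ≡ suc k → Nonempty p
∣p∣≡1+k⇒nonempty (inside  ∷ p) _ = zero , here
∣p∣≡1+k⇒nonempty (outside ∷ p) e with ∣p∣≡1+k⇒nonempty p e
... | x , x∈p = suc x , there x∈p

∈-tabulate⁺ : ∀ {n} {f : Fin n → Bool} {x} → f x ≡ true → x ∈ tabulate f
∈-tabulate⁺ {f = f} {x} fx = lookup⇒[]= x (tabulate f) (trans (lookup∘tabulate f x) fx)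

∈-tabulate⁻ : ∀ {n} {f : Fin n → Bool} {x} → x ∈ tabulate f → f x ≡ true
∈-tabulate⁻ {f = f} {x} x∈ = trans (sym (lookup∘tabulate f x)) ([]=⇒lookup x∈)

lookup⇒∈ : ∀ {n} {p : Subset n} {x} → lookup p x ≡ true → x ∈ p
lookup⇒∈ {p = p} {x} = lookup⇒[]= x p

lookup≡false⇒∉ : ∀ {n} {p : Subset n} {x} → lookup p x ≡ false → x ∉ p
lookup≡false⇒∉ px≡false x∈p with () ← trans (sym ([]=⇒lookup x∈p)) px≡false

∉⇒lookup≡false : ∀ {n} {p : Subset n} {x} → x ∉ p → lookup p x ≡ false
∉⇒lookup≡false {p = p} {x} x∉p with lookup p x in e
... | true  = ⊥-elim (x∉p (lookup⇒[]= x p e))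
... | false = refl

lookup-∪ : ∀ {n} (p q : Subset n) x → lookup (p ∪ q) x ≡ lookup p x ∨ lookup q x
lookup-∪ p q x = lookup-zipWith _∨_ x p q

lookup-⁅⁆ : ∀ {n} (y x : Fin n) → lookup ⁅ y ⁆ x ≡ ⌊ x ≟ᶠ y ⌋
lookup-⁅⁆ y x with x ≟ᶠ y
... | yes refl = []=⇒lookup (x∈⁅x⁆ x)
... | no  x≢y  = ∉⇒lookup≡false (x≢y⇒x∉⁅y⁆ x≢y)

-- Kernels

dot : ∀ {n} → (Fin n → Bool) → (Fin n → Bool) → Bool
dot u x = sumF2 (λ j → u j ∧ x j)

_[_]≔_ : ∀ {n} → (Fin n → Bool) → Fin n → Bool → Fin n → Bool
x [ j ]≔ v = updateAt x j (const v)

xor-cancelʳ : ∀ a b → (a xor b) xor b ≡ a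
xor-cancelʳ a b = trans (xor-assoc a b b) (trans (cong (a xor_) (xor-same b)) (xor-identityʳ a))

dot-update : ∀ {n} (u x : Fin n → Bool) j v → dot u (x [ j ]≔ v) ≡ (u j ∧ (v xor x j)) xor dot u x
dot-update {n} u x j v = begin
  dot u y                                              ≡⟨ sym (xor-cancelʳ (dot u y) (dot u x)) ⟩
  (dot u y xor dot u x) xor dot u x                    ≡⟨ cong (_xor dot u x)
      (sym (sumF2-xor (λ k → u k ∧ y k) (λ k → u k ∧ x k))) ⟩
  sumF2 (λ k → u k ∧ y k xor u k ∧ x k) xor dot u x    ≡⟨ cong (_xor dot u x)
      (sumF2-cong (λ k → sym (∧-distribˡ-xor (u k) (y k) (x k)))) ⟩
  sumF2 (λ k → u k ∧ (y k xor x k)) xor dot u x        ≡⟨ cong (_xor dot u x)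
      (sumF2-supported _ j unchanged) ⟩
  (u j ∧ (y j xor x j)) xor dot u x                    ≡⟨ cong
      (λ z → (u j ∧ (z xor x j)) xor dot u x) (updateAt-updates j x) ⟩
  (u j ∧ (v xor x j)) xor dot u x                      ∎
  where
  open ≡-Reasoning
  y : Fin n → Bool
  y = x [ j ]≔ v
  unchanged : ∀ k → k ≢ j → u k ∧ (y k xor x k) ≡ false
  unchanged k k≢j = trans (cong (λ z → u k ∧ (z xor x k)) (updateAt-minimal k j x k≢j))
                          (trans (cong (u k ∧_) (xor-same (x k))) (∧-zeroʳ (u k)))

dot-lincomb : ∀ {d n} (u : Fin n → Bool) (a : Fin d → Bool) b →
  dot u (lincomb a b) ≡ sumF2 (λ i → a i ∧ dot u (b i))
dot-lincomb u a b = begin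
  sumF2 (λ j → u j ∧ sumF2 (λ i → a i ∧ b i j))      ≡⟨ sumF2-cong
      (λ j → ∧-distribˡ-sumF2 (u j) (λ i → a i ∧ b i j)) ⟩
  sumF2 (λ j → sumF2 (λ i → u j ∧ (a i ∧ b i j)))    ≡⟨ sumF2-comm (λ j i → u j ∧ (a i ∧ b i j)) ⟩
  sumF2 (λ i → sumF2 (λ j → u j ∧ (a i ∧ b i j)))    ≡⟨ sumF2-cong
      (λ i → sumF2-cong (λ j → swap (u j) (a i) (b i j))) ⟩
  sumF2 (λ i → sumF2 (λ j → a i ∧ (u j ∧ b i j)))    ≡⟨ sumF2-cong
      (λ i → sym (∧-distribˡ-sumF2 (a i) (λ j → u j ∧ b i j))) ⟩
  sumF2 (λ i → a i ∧ dot u (b i))                    ∎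
  where
  open ≡-Reasoning
  swap : ∀ x y z → x ∧ (y ∧ z) ≡ y ∧ (x ∧ z)
  swap false y z = sym (∧-zeroʳ y)
  swap true  y z = refl

lincomb-vanishing : ∀ {d n} (a : Fin d → Bool) (b : Fin d → Fin n → Bool) j →
  (∀ i → b i j ≡ false) → lincomb a b j ≡ false
lincomb-vanishing a b j b-at-j = sumF2-zero (λ i → trans (cong (a i ∧_) (b-at-j i)) (∧-zeroʳ (a i)))

lincomb-update-≢ : ∀ {d n} (a : Fin d → Bool) (b : Fin d → Fin n → Bool) (σ : Fin d → Bool) {j k} →
  k ≢ j → lincomb a (λ i → b i [ j ]≔ σ i) k ≡ lincomb a b k
lincomb-update-≢ a b σ {j} {k} k≢j = sumF2-cong (λ i → cong (a i ∧_) (updateAt-minimal k j (b i) k≢j))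

clear-column : ∀ {m n} {M : Matrix m n} {C C' V} {x : Fin n → Bool} j →
  (∀ {r} → r ∈ C' → r ∈ C) → (∀ {r} → r ∈ C' → M r j ≡ false) →
  InKer M C V x → InKer M C' (V - j) (x [ j ]≔ false)
clear-column {M = M} {C' = C'} {V = V} {x} j C'⊆C Mj≡0 (x-out , x-rows) = out , rows
  where
  out : ∀ k → k ∉ V - j → (x [ j ]≔ false) k ≡ false
  out k k∉V-j with k ≟ᶠ j
  ... | yes refl = updateAt-updates j x
  ... | no  k≢j  = trans (updateAt-minimal k j x k≢j) (x-out k (λ k∈V → k∉V-j (x∈p∧x≢y⇒x∈p-y k∈V k≢j)))
  rows : ∀ r → r ∈ C' → dot (M r) (x [ j ]≔ false) ≡ false
  rows r r∈C' = trans (dot-update (M r) x j false)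
                      (cong₂ (λ c z → (c ∧ (false xor x j)) xor z) (Mj≡0 r∈C') (x-rows r (C'⊆C r∈C')))

ker-duplicate-row : ∀ {m n} {M : Matrix m n} {C V r r' d} → r' ∈ C → r' ≢ r →
  (∀ j → j ∈ V → M r j ≡ M r' j) → KerDim M (C - r) V d → KerDim M C V d
ker-duplicate-row {M = M} {C} {V} {r} {r'} r'∈C r'≢r same (b , b∈ker , b-indep , b-span) =
  b , (λ i → restore (b∈ker i)) , b-indep , (λ x x∈ker → b-span x (forget x∈ker))
  where
  forget : ∀ {x} → InKer M C V x → InKer M (C - r) V x
  forget (out , rows) = out , (λ r'' r''∈ → rows r'' (x∈p-y⇒x∈p r''∈))
  restore : ∀ {x} → InKer M (C - r) V x → InKer M C V x
  restore {x} (out , rows) = out , rows'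
    where
    agree : ∀ j → M r j ∧ x j ≡ M r' j ∧ x j
    agree j with j ∈? V
    ... | yes j∈V = cong (_∧ x j) (same j j∈V)
    ... | no  j∉V rewrite out j j∉V = trans (∧-zeroʳ (M r j)) (sym (∧-zeroʳ (M r' j)))
    rows' : ∀ r'' → r'' ∈ C → dot (M r'') x ≡ false
    rows' r'' r''∈C with r'' ≟ᶠ r
    ... | yes refl = trans (sumF2-cong agree) (rows r' (x∈p∧x≢y⇒x∈p-y r'∈C r'≢r))
    ... | no  r''≢r = rows r'' (x∈p∧x≢y⇒x∈p-y r''∈C r''≢r)

record Pivot {m n} (M : Matrix m n) (C : Subset m) (V : Subset n) (r : Fin m) (j : Fin n) : Set where
  field
    col∈V  : j ∈ V
    row∈C  : r ∈ C
    entry  : M r j ≡ true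
    unique : ∀ {r'} → r' ∈ C → M r' j ≡ true → r' ≡ r

  others-zero : ∀ {r'} → r' ∈ C - r → M r' j ≡ false
  others-zero {r'} r'∈C-r with M r' j in e
  ... | true  = ⊥-elim (x∈p-y⇒x≢y r'∈C-r (unique (x∈p-y⇒x∈p r'∈C-r) e))
  ... | false = refl

ker-peel : ∀ {m n} {M : Matrix m n} {C V r j d} → Pivot M C V r j →
  KerDim M (C - r) (V - j) d → KerDim M C V d
ker-peel {n = n} {M = M} {C} {V} {r} {j} {d} pivot (b , b∈ker , b-indep , b-span) =
  b' , b'∈ker , b'-indep , b'-span
  where
  open Pivot pivot
  -- the value at j is forced by the equation of row r
  σ : Fin d → Bool
  σ i = dot (M r) (b i)
  b' : Fin d → Fin n → Bool
  b' i = b i [ j ]≔ σ i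
  b-at-j : ∀ i → b i j ≡ false
  b-at-j i = proj₁ (b∈ker i) j (x∉p-x V j)

  b'∈ker : ∀ i → InKer M C V (b' i)
  b'∈ker i = out , rows
    where
    out : ∀ k → k ∉ V → b' i k ≡ false
    out k k∉V = trans (updateAt-minimal k j (b i) (λ { refl → k∉V col∈V }))
                      (proj₁ (b∈ker i) k (λ k∈V-j → k∉V (x∈p-y⇒x∈p k∈V-j)))
    rows : ∀ r' → r' ∈ C → dot (M r') (b' i) ≡ false
    rows r' r'∈C with r' ≟ᶠ r
    ... | yes refl = trans (dot-update (M r) (b i) j (σ i))
                           (trans (cong₂ (λ c z → (c ∧ (σ i xor z)) xor σ i) entry (b-at-j i))
                                  (trans (cong (_xor σ i) (xor-identityʳ (σ i))) (xor-same (σ i))))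
    ... | no r'≢r  = trans (dot-update (M r') (b i) j (σ i))
                           (trans (cong (λ c → (c ∧ (σ i xor b i j)) xor dot (M r') (b i))
                               (others-zero r'∈C-r))
                                  (proj₂ (b∈ker i) r' r'∈C-r))
      where r'∈C-r = x∈p∧x≢y⇒x∈p-y r'∈C r'≢r

  b'-indep : LinIndep b'
  b'-indep a a·b'≡0 = b-indep a a·b≡0
    where
    a·b≡0 : ∀ k → lincomb a b k ≡ false
    a·b≡0 k with k ≟ᶠ j
    ... | yes refl = lincomb-vanishing a b j b-at-j
    ... | no  k≢j  = trans (sym (lincomb-update-≢ a b σ {j} k≢j)) (a·b'≡0 k)

  b'-span : ∀ x → InKer M C V x → ∃ λ a → ∀ k → x k ≡ lincomb a b' k
  b'-span x x∈ker with b-span (x [ j ]≔ false) (clear-column j x∈p-y⇒x∈p others-zero x∈ker)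
  ... | a , x⁻≡a·b = a , coords
    where
    open ≡-Reasoning
    at-j : lincomb a b' j ≡ x j
    at-j = begin
      sumF2 (λ i → a i ∧ b' i j)                ≡⟨ sumF2-cong
          (λ i → cong (a i ∧_) (updateAt-updates j (b i))) ⟩
      sumF2 (λ i → a i ∧ σ i)                   ≡⟨ sym (dot-lincomb (M r) a b) ⟩
      dot (M r) (lincomb a b)                   ≡⟨ sumF2-cong (λ k → cong (M r k ∧_) (sym (x⁻≡a·b k))) ⟩
      dot (M r) (x [ j ]≔ false)                ≡⟨ dot-update (M r) x j false ⟩
      (M r j ∧ x j) xor dot (M r) x             ≡⟨ cong₂ (λ c z → (c ∧ x j) xor z) entry
          (proj₂ x∈ker r row∈C) ⟩
      x j xor false                             ≡⟨ xor-identityʳ (x j) ⟩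
      x j                                       ∎
    coords : ∀ k → x k ≡ lincomb a b' k
    coords k with k ≟ᶠ j
    ... | yes refl = sym at-j
    ... | no  k≢j  = trans (sym (updateAt-minimal k j x k≢j))
        (trans (x⁻≡a·b k) (sym (lincomb-update-≢ a b σ {j} k≢j)))

ker-free : ∀ {m n} {M : Matrix m n} {C V j d} → j ∈ V → (∀ {r} → r ∈ C → M r j ≡ false) →
  KerDim M C (V - j) d → KerDim M C V (suc d)
ker-free {n = n} {M = M} {C} {V} {j} {d} j∈V Mj≡0 (b , b∈ker , b-indep , b-span) =
  b' , b'∈ker , b'-indep , b'-span
  where
  eⱼ : Fin n → Bool
  eⱼ = (λ _ → false) [ j ]≔ true
  b' : Fin (suc d) → Fin n → Bool
  b' zero    = eⱼ
  b' (suc i) = b i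

  eⱼ-off-j : ∀ k → k ≢ j → eⱼ k ≡ false
  eⱼ-off-j k k≢j = updateAt-minimal k j (λ _ → false) k≢j

  b'∈ker : ∀ i → InKer M C V (b' i)
  b'∈ker zero    = (λ k k∉V → eⱼ-off-j k (λ { refl → k∉V j∈V })) , rows
    where
    rows : ∀ r → r ∈ C → dot (M r) eⱼ ≡ false
    rows r r∈C = trans (dot-update (M r) (λ _ → false) j true)
                       (cong₂ (λ c z → (c ∧ true) xor z) (Mj≡0 r∈C) (sumF2-zero (λ k → ∧-zeroʳ (M r k))))
  b'∈ker (suc i) = (λ k k∉V → proj₁ (b∈ker i) k (λ k∈V-j → k∉V (x∈p-y⇒x∈p k∈V-j))) , proj₂ (b∈ker i)

  b-at-j : ∀ i → b i j ≡ false
  b-at-j i = proj₁ (b∈ker i) j (x∉p-x V j)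

  b'-indep : LinIndep b'
  b'-indep a a·b'≡0 = coeffs
    where
    a₀≡0 : a zero ≡ false
    a₀≡0 = begin
      a zero                                                ≡⟨ sym (∧-identityʳ (a zero)) ⟩
      a zero ∧ true                                         ≡⟨ cong (a zero ∧_)
          (sym (updateAt-updates j (λ _ → false))) ⟩
      a zero ∧ eⱼ j                                         ≡⟨ sym (xor-identityʳ _) ⟩
      (a zero ∧ eⱼ j) xor false                             ≡⟨ cong ((a zero ∧ eⱼ j) xor_)
          (sym (lincomb-vanishing (a ∘ suc) b j b-at-j)) ⟩
      (a zero ∧ eⱼ j) xor lincomb (a ∘ suc) b j             ≡⟨ a·b'≡0 j ⟩
      false                                                 ∎
      where open ≡-Reasoning
    coeffs : ∀ i → a i ≡ false
    coeffs zero    = a₀≡0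
    coeffs (suc i) = b-indep (a ∘ suc)
        (λ k → trans (cong (λ c → (c ∧ eⱼ k) xor lincomb (a ∘ suc) b k) (sym a₀≡0)) (a·b'≡0 k)) i

  b'-span : ∀ x → InKer M C V x → ∃ λ a → ∀ k → x k ≡ lincomb a b' k
  b'-span x x∈ker with b-span (x [ j ]≔ false) (clear-column j (λ r∈C → r∈C) Mj≡0 x∈ker)
  ... | a , x⁻≡a·b = a' , coords
    where
    a' : Fin (suc d) → Bool
    a' zero    = x j
    a' (suc i) = a i
    coords : ∀ k → x k ≡ lincomb a' b' k
    coords k with k ≟ᶠ j
    ... | yes refl = sym (trans (cong₂ _xor_
        (trans (cong (x k ∧_) (updateAt-updates k (λ _ → false))) (∧-identityʳ (x k)))
                                             (trans (sym (x⁻≡a·b k)) (updateAt-updates k x)))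
                                (xor-identityʳ (x k)))
    ... | no  k≢j  = trans (sym (updateAt-minimal k j x k≢j))
                           (trans (x⁻≡a·b k) (sym (cong (_xor lincomb a b k)
                               (trans (cong (x j ∧_) (eⱼ-off-j k k≢j)) (∧-zeroʳ (x j))))))

ker-without-rows : ∀ {m n} {M : Matrix m n} {C} → (∀ r → r ∉ C) → ∀ V → KerDim M C V ∣ V ∣
ker-without-rows {M = M} {C} no-rows V = go ∣ V ∣ V refl
  where
  go : ∀ k V → ∣ V ∣ ≡ k → KerDim M C V k
  go zero V ∣V∣≡0 = (λ ()) , (λ ()) , (λ _ _ ()) , (λ x x∈ker → (λ ()) , λ j → proj₁ x∈ker j (V-empty j))
    where
    V-empty : ∀ j → j ∉ V
    V-empty j j∈V with () ← trans (sym ∣V∣≡0) (∣p∣≡1+∣p-x∣ j∈V)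
  go (suc k) V ∣V∣≡1+k with ∣p∣≡1+k⇒nonempty V ∣V∣≡1+k
  ... | j , j∈V = ker-free j∈V (λ {r} r∈C → ⊥-elim (no-rows r r∈C))
                    (go k (V - j) (suc-injective (trans (sym (∣p∣≡1+∣p-x∣ j∈V)) ∣V∣≡1+k)))

length≤∣p∣ : ∀ {n} {p : Subset n} {xs} → Unique xs → All (_∈ p) xs → length xs ≤ ∣ p ∣
length≤∣p∣ []                 []              = z≤n
length≤∣p∣ {p = p} (x∉xs ∷ u) (x∈p ∷ xs⊆p) rewrite ∣p∣≡1+∣p-x∣ x∈p =
  s≤s (length≤∣p∣ u (remove x∉xs xs⊆p))
  where
  remove : ∀ {x ys} → All (λ y → ¬ x ≡ y) ys → All (_∈ p) ys → All (_∈ p - x) ys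
  remove []           []            = []
  remove (x≢y ∷ x≢ys) (y∈p ∷ ys⊆p) = x∈p∧x≢y⇒x∈p-y y∈p (λ y≡x → x≢y (sym y≡x)) ∷ remove x≢ys ys⊆p

∣p∣≤length : ∀ {n} {p : Subset n} xs → (∀ {y} → y ∈ p → y ∈ˡ xs) → ∣ p ∣ ≤ length xs
∣p∣≤length {p = p} [] p⊆[] with ∣ p ∣ in ∣p∣≡
... | zero  = z≤n
... | suc _ with () ← p⊆[] (proj₂ (∣p∣≡1+k⇒nonempty p ∣p∣≡))
∣p∣≤length {p = p} (x ∷ xs) p⊆x∷xs with x ∈? p
... | yes x∈p rewrite ∣p∣≡1+∣p-x∣ x∈p = s≤s (∣p∣≤length xs p-x⊆xs)
  where
  p-x⊆xs : ∀ {y} → y ∈ p - x → y ∈ˡ xs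
  p-x⊆xs y∈p-x with p⊆x∷xs (x∈p-y⇒x∈p y∈p-x)
  ... | here y≡x   = ⊥-elim (x∈p-y⇒x≢y y∈p-x y≡x)
  ... | there y∈xs = y∈xs
... | no  x∉p = m≤n⇒m≤1+n (∣p∣≤length xs p⊆xs)
  where
  p⊆xs : ∀ {y} → y ∈ p → y ∈ˡ xs
  p⊆xs y∈p with p⊆x∷xs y∈p
  ... | here refl  = ⊥-elim (x∉p y∈p)
  ... | there y∈xs = y∈xs

∣p∣≡1 : ∀ {n} {p : Subset n} {x} → x ∈ p → (∀ {y} → y ∈ p → y ≡ x) → ∣ p ∣ ≡ 1
∣p∣≡1 x∈p only-x = ≤-antisym (∣p∣≤length (_ ∷ []) (λ y∈p → here (only-x y∈p)))
    (length≤∣p∣ ([] ∷ []) (x∈p ∷ []))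

weight-≥ : ∀ {n} {f : Fin n → Bool} {js} → Unique js → All (λ j → f j ≡ true) js → length js ≤ weight f
weight-≥ u fjs = length≤∣p∣ u (All.map ∈-tabulate⁺ fjs)

weight-≤ : ∀ {n} {f : Fin n → Bool} js → (∀ {j} → f j ≡ true → j ∈ˡ js) → weight f ≤ length js
weight-≤ js covers = ∣p∣≤length js (covers ∘ ∈-tabulate⁻)

∣initialSegment∣ : ∀ {n} (p : Subset n) c → c ≤ n → (∀ j → lookup p j ≡ (toℕ j <ᵇ c)) → ∣ p ∣ ≡ c
∣initialSegment∣ p zero _ below =
  n≤0⇒n≡0 (∣p∣≤length {p = p} [] (λ {j} j∈p → ⊥-elim (lookup≡false⇒∉ (below j) j∈p)))
∣initialSegment∣ (b ∷ p) (suc c) (s≤s c≤n) below with b | below zero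
... | true | _ = cong suc (∣initialSegment∣ p c c≤n (λ j → below (suc j)))

colWeightIn≡1 : ∀ {m n} {M : Matrix m n} {C V r j} → Pivot M C V r j → colWeightIn M C j ≡ 1
colWeightIn≡1 pivot = ∣p∣≡1 (x∈p∩q⁺ (row∈C , ∈-tabulate⁺ entry))
  (λ r'∈ → let (r'∈C , r'∈col) = x∈p∩q⁻ _ _ r'∈ in unique r'∈C (∈-tabulate⁻ r'∈col))
  where open Pivot pivot

twin-rows⇒colWeightIn≢1 : ∀ {m n} {M : Matrix m n} {C r₁ r₂} → r₁ ≢ r₂ → r₁ ∈ C → r₂ ∈ C →
  (∀ {r} → r ∈ C → r ≡ r₁ ⊎ r ≡ r₂) → M r₁ ≗ M r₂ → ∀ j → colWeightIn M C j ≢ 1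
twin-rows⇒colWeightIn≢1 {M = M} {C} {r₁} {r₂} r₁≢r₂ r₁∈C r₂∈C only M₁≗M₂ j with M r₂ j in M₂j
... | true  = λ w≡1 → <-irrefl (sym w≡1)
                (length≤∣p∣ ((r₁≢r₂ ∷ []) ∷ [] ∷ [])
                            (in-col r₁∈C (trans (M₁≗M₂ j) M₂j) ∷ in-col r₂∈C M₂j ∷ []))
  where
  in-col : ∀ {r} → r ∈ C → M r j ≡ true → r ∈ C ∩ tabulate (λ r → M r j)
  in-col r∈C Mrj = x∈p∩q⁺ (r∈C , ∈-tabulate⁺ Mrj)
... | false = λ w≡1 → 0≢1+n (trans (sym (n≤0⇒n≡0 (∣p∣≤length [] col-empty))) w≡1)
  where
  col-empty : ∀ {r} → r ∈ C ∩ tabulate (λ r → M r j) → r ∈ˡ []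
  col-empty r∈ with x∈p∩q⁻ _ _ r∈
  ... | r∈C , r∈col with only r∈C | ∈-tabulate⁻ r∈col
  ... | inj₁ refl | Mr₁j with () ← trans (sym Mr₁j) (trans (M₁≗M₂ j) M₂j)
  ... | inj₂ refl | Mr₂j with () ← trans (sym Mr₂j) M₂j

-- Peeling a sequence of pivots

removeFirst : ∀ {n} → Subset n → (ℕ → Fin n) → ℕ → Subset n
removeFirst C f zero    = C
removeFirst C f (suc t) = removeFirst C f t - f t

removeFirst⁺ : ∀ {n} {C : Subset n} {f x} t → x ∈ C → (∀ t' → t' < t → x ≢ f t') → x ∈ removeFirst C f t
removeFirst⁺ zero    x∈C _   = x∈C
removeFirst⁺ (suc t) x∈C x≢f =
  x∈p∧x≢y⇒x∈p-y (removeFirst⁺ t x∈C (λ t' t'<t → x≢f t' (m<n⇒m<1+n t'<t))) (x≢f t (n<1+n t))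

removeFirst⊆ : ∀ {n} {C : Subset n} {f x} t → x ∈ removeFirst C f t → x ∈ C
removeFirst⊆ zero    x∈ = x∈
removeFirst⊆ (suc t) x∈ = removeFirst⊆ t (x∈p-y⇒x∈p x∈)

removeFirst-removed : ∀ {n} {C : Subset n} {f x} t → x ∈ removeFirst C f t → ∀ t' → t' < t → x ≢ f t'
removeFirst-removed (suc t) x∈ t' t'<1+t with t' ℕ.≟ t
... | yes refl = x∈p-y⇒x≢y x∈
... | no  t'≢t = removeFirst-removed t (x∈p-y⇒x∈p x∈) t' (≤∧≢⇒< (≤-pred t'<1+t) t'≢t)

∣removeFirst∣ : ∀ {n} {V : Subset n} {f} t → (∀ t' → t' < t → f t' ∈ removeFirst V f t') →
  ∣ removeFirst V f t ∣ + t ≡ ∣ V ∣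
∣removeFirst∣ zero    _      = +-identityʳ _
∣removeFirst∣ {V = V} {f} (suc t) f∈ = begin
  ∣ removeFirst V f t - f t ∣ + suc t    ≡⟨ +-suc _ t ⟩
  suc ∣ removeFirst V f t - f t ∣ + t    ≡⟨ cong (_+ t) (sym (∣p∣≡1+∣p-x∣ (f∈ t (n<1+n t)))) ⟩
  ∣ removeFirst V f t ∣ + t              ≡⟨ ∣removeFirst∣ t (λ t' t'<t → f∈ t' (m<n⇒m<1+n t'<t)) ⟩
  ∣ V ∣                                  ∎
  where open ≡-Reasoning

PivotSequence : ∀ {m n} → Matrix m n → Subset m → Subset n → (ℕ → Fin m) → (ℕ → Fin n) → ℕ → Set
PivotSequence M C V rows cols T =
  ∀ t → t < T → Pivot M (removeFirst C rows t) (removeFirst V cols t) (rows t) (cols t)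

ker-peel* : ∀ {m n} {M : Matrix m n} {C V rows cols d} T → PivotSequence M C V rows cols T →
  KerDim M (removeFirst C rows T) (removeFirst V cols T) d → KerDim M C V d
ker-peel* zero    _      k = k
ker-peel* (suc T) pivots k =
  ker-peel* T (λ t t<T → pivots t (m<n⇒m<1+n t<T)) (ker-peel (pivots T (n<1+n T)) k)

strip-peel* : ∀ {m n} {M : Matrix m n} {C V rows cols C' V'} T → PivotSequence M C V rows cols T →
  StripRun M (removeFirst C rows T) (removeFirst V cols T) C' V' → StripRun M C V C' V'
strip-peel* zero    _      s = s
strip-peel* {M = M} {C} {V} {rows} {cols} (suc T) pivots s =
  strip-peel* T (λ t t<T → pivots t (m<n⇒m<1+n t<T))
    (step (cols T) (rows T) col∈V (colWeightIn≡1 pivot) row∈C entry s)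
  where
  pivot : Pivot M (removeFirst C rows T) (removeFirst V cols T) (rows T) (cols T)
  pivot = pivots T (n<1+n T)
  open Pivot pivot

-- Runs of the finder loop along a prescribed sequence of rows

record State (m n : ℕ) : Set where
  constructor state
  field
    current : Matrix m n
    chosen  : Subset m
    covered : Subset n
open State

choose : ∀ {m n} → Fin m → State m n → State m n
choose c (state H C V) = state (zeroCols H (rowSupport H c)) (C ∪ ⁅ c ⁆) (V ∪ rowSupport H c)

run : ∀ {m n} → Matrix m n → (ℕ → Fin m) → ℕ → State m n
run M cs zero    = state M ⊥ ⊥
run M cs (suc s) = choose (cs s) (run M cs s)

record ContinuingChoice {m n} (S : State m n) (c : Fin m) : Set where
  field
    chosen≢⊤  : chosen S ≢ ⊤
    covered≢⊤ : covered S ≢ ⊤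
    lightest  : Lightest (current S) (chosen S) c
    nonempty  : Nonempty (rowSupport (current S) c)

finder-after : ∀ {m n} {M : Matrix m n} {cs C' V'} t →
  (∀ s → s < t → ContinuingChoice (run M cs s) (cs s)) →
  Finder M (current (run M cs t)) (chosen (run M cs t)) (covered (run M cs t)) C' V' →
  Finder M M ⊥ ⊥ C' V'
finder-after zero    _  finder = finder
finder-after {cs = cs} (suc t) ok finder =
  finder-after t (λ s s<t → ok s (m<n⇒m<1+n s<t))
    (continue (cs t) chosen≢⊤ covered≢⊤ lightest (inj₁ nonempty) finder)
  where open ContinuingChoice (ok t (n<1+n t))

isCovered : ∀ {m n} → Matrix m n → (ℕ → Fin m) → ℕ → Fin n → Bool
isCovered M cs s j = lookup (covered (run M cs s)) j

current-run : ∀ {m n} (M : Matrix m n) cs s r j → current (run M cs s) r j ≡ M r j ∧ not (isCovered M cs s j)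
isCovered-suc : ∀ {m n} (M : Matrix m n) cs s j → isCovered M cs (suc s) j ≡ isCovered M cs s j ∨ M (cs s) j

current-run M cs zero r j =
  trans (sym (∧-identityʳ (M r j))) (cong (λ v → M r j ∧ not v) (sym (lookup-replicate j outside)))
current-run {m} {n} M cs (suc s) r j = begin
  H r j ∧ not (lookup (tabulate (H (cs s))) j) ≡⟨ cong (λ z → H r j ∧ not z) (lookup∘tabulate (H (cs s)) j) ⟩
  H r j ∧ not (H (cs s) j)                     ≡⟨ cong₂ (λ a b → a ∧ not b) (current-run M cs s r j)
      (current-run M cs s (cs s) j) ⟩
  (M r j ∧ not v) ∧ not (M (cs s) j ∧ not v)   ≡⟨ clear (M r j) (M (cs s) j) v ⟩
  M r j ∧ not (v ∨ M (cs s) j)                 ≡⟨ cong (λ z → M r j ∧ not z) (sym (isCovered-suc M cs s j)) ⟩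
  M r j ∧ not (isCovered M cs (suc s) j)       ∎
  where
  open ≡-Reasoning
  H : Matrix m n
  H = current (run M cs s)
  v : Bool
  v = isCovered M cs s j
  clear : ∀ a b v → (a ∧ not v) ∧ not (b ∧ not v) ≡ a ∧ not (v ∨ b)
  clear a     b     true  = trans (cong (λ x → x ∧ not (b ∧ false)) (∧-zeroʳ a)) (sym (∧-zeroʳ a))
  clear true  b     false = cong not (∧-identityʳ b)
  clear false b     false = refl

isCovered-suc {m} {n} M cs s j = begin
  lookup (V ∪ tabulate (H (cs s))) j      ≡⟨ lookup-∪ V (tabulate (H (cs s))) j ⟩
  v ∨ lookup (tabulate (H (cs s))) j      ≡⟨ cong (v ∨_)
      (trans (lookup∘tabulate (H (cs s)) j) (current-run M cs s (cs s) j)) ⟩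
  v ∨ (M (cs s) j ∧ not v)                ≡⟨ absorb v (M (cs s) j) ⟩
  v ∨ M (cs s) j                          ∎
  where
  open ≡-Reasoning
  H : Matrix m n
  H = current (run M cs s)
  V : Subset n
  V = covered (run M cs s)
  v : Bool
  v = isCovered M cs s j
  absorb : ∀ v b → v ∨ (b ∧ not v) ≡ v ∨ b
  absorb true  b = refl
  absorb false b = cong (false ∨_) (∧-identityʳ b)

isCovered-false : ∀ {m n} (M : Matrix m n) cs s j → (∀ s' → s' < s → M (cs s') j ≡ false) →
  isCovered M cs s j ≡ false
isCovered-false M cs zero    j _ = lookup-replicate j outside
isCovered-false M cs (suc s) j untouched = trans (isCovered-suc M cs s j)
  (cong₂ _∨_ (isCovered-false M cs s j (λ s' s'<s → untouched s' (m<n⇒m<1+n s'<s))) (untouched s (n<1+n s)))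

isCovered-true : ∀ {m n} (M : Matrix m n) cs s j s' → s' < s → M (cs s') j ≡ true → isCovered M cs s j ≡ true
isCovered-true M cs (suc s) j s' s'<1+s Mj with s' ℕ.≟ s
... | yes refl = trans (isCovered-suc M cs s j) (trans (cong (isCovered M cs s' j ∨_) Mj) (∨-zeroʳ _))
... | no  s'≢s = trans (isCovered-suc M cs s j)
  (cong (_∨ M (cs s) j) (isCovered-true M cs s j s' (≤∧≢⇒< (≤-pred s'<1+s) s'≢s) Mj))

chosen-suc : ∀ {m n} (M : Matrix m n) cs s r →
  lookup (chosen (run M cs (suc s))) r ≡ lookup (chosen (run M cs s)) r ∨ ⌊ r ≟ᶠ cs s ⌋
chosen-suc M cs s r = trans (lookup-∪ (chosen (run M cs s)) ⁅ cs s ⁆ r)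
    (cong (lookup (chosen (run M cs s)) r ∨_) (lookup-⁅⁆ (cs s) r))

<ᵇ-true : ∀ {a b} → a < b → (a <ᵇ b) ≡ true
<ᵇ-true {zero}  {suc b} _       = refl
<ᵇ-true {suc a} {suc b} (s≤s p) = <ᵇ-true {a} {b} p

<ᵇ-false : ∀ {a b} → b ≤ a → (a <ᵇ b) ≡ false
<ᵇ-false {a}     {zero}  _       = refl
<ᵇ-false {suc a} {suc b} (s≤s p) = <ᵇ-false {a} {b} p

<ᵇ-true⁻ : ∀ {a b} → (a <ᵇ b) ≡ true → a < b
<ᵇ-true⁻ {zero}  {suc b} _ = s≤s z≤n
<ᵇ-true⁻ {suc a} {suc b} e = s≤s (<ᵇ-true⁻ {a} {b} e)

<ᵇ-false⁻ : ∀ {a b} → (a <ᵇ b) ≡ false → b ≤ a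
<ᵇ-false⁻ {a}     {zero}  _ = z≤n
<ᵇ-false⁻ {suc a} {suc b} e = s≤s (<ᵇ-false⁻ {a} {b} e)

≡ᵇ-true : ∀ {a b} → a ≡ b → (a ≡ᵇ b) ≡ true
≡ᵇ-true {zero}  refl = refl
≡ᵇ-true {suc a} refl = ≡ᵇ-true {a} refl

≡ᵇ-false : ∀ {a b} → a ≢ b → (a ≡ᵇ b) ≡ false
≡ᵇ-false {zero}  {zero}  a≢b = ⊥-elim (a≢b refl)
≡ᵇ-false {zero}  {suc b} _   = refl
≡ᵇ-false {suc a} {zero}  _   = refl
≡ᵇ-false {suc a} {suc b} a≢b = ≡ᵇ-false {a} {b} (a≢b ∘ cong suc)

≡ᵇ-true⁻ : ∀ {a b} → (a ≡ᵇ b) ≡ true → a ≡ b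
≡ᵇ-true⁻ {zero}  {zero}  _ = refl
≡ᵇ-true⁻ {suc a} {suc b} e = cong suc (≡ᵇ-true⁻ e)

<ᵇ-suc : ∀ a s → (a <ᵇ s) ∨ (a ≡ᵇ s) ≡ (a <ᵇ suc s)
<ᵇ-suc zero    zero    = refl
<ᵇ-suc zero    (suc s) = refl
<ᵇ-suc (suc a) zero    = refl
<ᵇ-suc (suc a) (suc s) = <ᵇ-suc a s

-- Out-of-range numbers are sent to zero; every use below is in range.
toFin : ∀ {n} → ℕ → Fin (suc n)
toFin {n} v with v ℕ.<? suc n
... | yes v<1+n = fromℕ< v<1+n
... | no  _     = zero

toℕ-toFin : ∀ {n} v → v < suc n → toℕ (toFin {n} v) ≡ v
toℕ-toFin {n} v v<1+n with v ℕ.<? suc n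
... | yes p = toℕ-fromℕ< p
... | no ¬p = ⊥-elim (¬p v<1+n)

toFin-toℕ : ∀ {n} (x : Fin (suc n)) → toFin (toℕ x) ≡ x
toFin-toℕ {n} x with toℕ x ℕ.<? suc n
... | yes p = fromℕ<-toℕ x p
... | no ¬p = ⊥-elim (¬p (toℕ<n x))

toℕ≡⇒≡toFin : ∀ {n} (x : Fin (suc n)) {v} → toℕ x ≡ v → x ≡ toFin v
toℕ≡⇒≡toFin x e = trans (sym (toFin-toℕ x)) (cong toFin e)

toFin-≢ : ∀ {n} {a b} → a < suc n → b < suc n → a ≢ b → toFin {n} a ≢ toFin b
toFin-≢ {a = a} {b} a< b< a≢b e = a≢b (trans (sym (toℕ-toFin a a<)) (trans (cong toℕ e) (toℕ-toFin b b<)))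

elem : ℕ → List ℕ → Bool
elem v []       = false
elem v (x ∷ xs) = (v ≡ᵇ x) ∨ elem v xs

elem⇒∈ : ∀ {v} xs → elem v xs ≡ true → v ∈ˡ xs
elem⇒∈ {v} (x ∷ xs) e with v ≡ᵇ x in v≡x
... | true  = here (≡ᵇ-true⁻ v≡x)
... | false = there (elem⇒∈ xs e)

∈⇒elem : ∀ {v} xs → v ∈ˡ xs → elem v xs ≡ true
∈⇒elem {v} (x ∷ xs) (here refl) rewrite ≡ᵇ-true {v} refl = refl
∈⇒elem {v} (x ∷ xs) (there v∈xs) rewrite ∈⇒elem xs v∈xs = ∨-zeroʳ (v ≡ᵇ x)

-- An index set made of consecutive blocks of the given sizes.
total : List ℕ → ℕ
total []       = 0
total (l ∷ ls) = l + total ls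

offset : List ℕ → ℕ → ℕ
offset []       _       = 0
offset (l ∷ ls) zero    = 0
offset (l ∷ ls) (suc c) = l + offset ls c

size : List ℕ → ℕ → ℕ
size []       _       = 0
size (l ∷ ls) zero    = l
size (l ∷ ls) (suc c) = size ls c

locate : List ℕ → ℕ → ℕ × ℕ
locate []       r = 0 , r
locate (l ∷ ls) r =
  if r <ᵇ l then (0 , r) else (suc (proj₁ (locate ls (r ∸ l))) , proj₂ (locate ls (r ∸ l)))

locate-offset : ∀ ls c i → i < size ls c → locate ls (offset ls c + i) ≡ (c , i)
locate-offset (l ∷ ls) zero    i i< rewrite <ᵇ-true i< = refl
locate-offset (l ∷ ls) (suc c) i i<
  rewrite <ᵇ-false {l + offset ls c + i} {l} (≤-trans (m≤m+n l (offset ls c)) (m≤m+n (l + offset ls c) i))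
        | +-assoc l (offset ls c) i | m+n∸m≡n l (offset ls c + i) | locate-offset ls c i i< = refl

BlockIndex : List ℕ → ℕ → Set
BlockIndex ls r = Σ ℕ λ c → Σ ℕ λ i → i < size ls c × r ≡ offset ls c + i

blockIndex : ∀ ls r → r < total ls → BlockIndex ls r
blockIndex (l ∷ ls) r r< with r ℕ.<? l
... | yes r<l = 0 , r , r<l , refl
... | no  r≮l with blockIndex ls (r ∸ l)
    (+-cancelˡ-< l (r ∸ l) (total ls) (subst (_< l + total ls) (sym (m+[n∸m]≡n (≮⇒≥ r≮l))) r<))
... | c , i , i< , e = suc c , i , i< , trans (sym (m+[n∸m]≡n (≮⇒≥ r≮l)))
    (trans (cong (l +_) e) (sym (+-assoc l (offset ls c) i)))

offset-mono : ∀ ls c c' → c < c' → c' ≤ length ls → offset ls c + size ls c ≤ offset ls c'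
offset-mono (l ∷ ls) zero    (suc c') _         _          = m≤m+n l (offset ls c')
offset-mono (l ∷ ls) (suc c) (suc c') (s≤s c<c') (s≤s c'≤) rewrite +-assoc l (offset ls c) (size ls c) =
  +-monoʳ-≤ l (offset-mono ls c c' c<c' c'≤)

offset+i<total : ∀ ls c i → i < size ls c → offset ls c + i < total ls
offset+i<total (l ∷ ls) zero    i i< = ≤-trans i< (m≤m+n l (total ls))
offset+i<total (l ∷ ls) (suc c) i i< rewrite +-assoc l (offset ls c) i = +-monoʳ-< l
    (offset+i<total ls c i i<)

offset-injective : ∀ ls {c i c' i'} → i < size ls c → i' < size ls c' →
  offset ls c + i ≡ offset ls c' + i' → c ≡ c' × i ≡ i'
offset-injective ls {c} {i} {c'} {i'} i< i'< e
  with trans (sym (locate-offset ls c i i<)) (trans (cong (locate ls) e) (locate-offset ls c' i' i'<))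
... | refl = refl , refl

module Construction (k0 : ℕ) where

  k : ℕ
  k = suc k0
  K : ℕ
  K = 3 * k
  K-1 : ℕ
  K-1 = k0 + 2 * k
  S : ℕ
  S = suc (suc K)

  -- Row blocks 0–5 are A (K rows), D (S rows), the single row T and B¹, B², B³ (k rows
  -- each); column blocks 0–6 have sizes K, K, K, S, S, k, k.  A_i meets columns (0,i),
  -- (1,i), (2,i); D_j meets (3,j), (4,j) and the column just before (3,j), which for
  -- j = 0 is (2,K-1); T = D_{K+1}; Bᵃ_l meets (3, a·k + l), (5,l), (6,l).  Rows and
  -- columns are numbered consecutively; colEntries (c , i) lists at most three rows,
  -- among them every row meeting column (c , i).
  rowBlocks colBlocks : List ℕ
  rowBlocks = K ∷ S ∷ 1 ∷ k ∷ k ∷ k ∷ []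
  colBlocks = K ∷ K ∷ K ∷ S ∷ S ∷ k ∷ k ∷ []

  m n : ℕ
  m = total rowBlocks
  n = total colBlocks

  firstRow firstCol : ℕ → ℕ
  firstRow = offset rowBlocks
  firstCol = offset colBlocks

  chainRow : ℕ → List ℕ
  chainRow j = firstCol 3 + j ∷ firstCol 4 + j ∷ firstCol 3 + j ∸ 1 ∷ []

  rowEntries : ℕ × ℕ → List ℕ
  rowEntries (0 , i) = firstCol 0 + i ∷ firstCol 1 + i ∷ firstCol 2 + i ∷ []
  rowEntries (1 , j) = chainRow j
  rowEntries (2 , _) = chainRow (suc K)
  rowEntries (3 , l) = firstCol 3 + l ∷ firstCol 5 + l ∷ firstCol 6 + l ∷ []
  rowEntries (4 , l) = firstCol 3 + (k + l) ∷ firstCol 5 + l ∷ firstCol 6 + l ∷ []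
  rowEntries (5 , l) = firstCol 3 + (k + (k + l)) ∷ firstCol 5 + l ∷ firstCol 6 + l ∷ []
  rowEntries _ = []

  colEntries : ℕ × ℕ → List ℕ
  colEntries (0 , i) = firstRow 0 + i ∷ []
  colEntries (1 , i) = firstRow 0 + i ∷ []
  colEntries (2 , i) = firstRow 0 + i ∷ firstRow 1 + 0 ∷ []
  colEntries (3 , j) = firstRow 1 + j ∷ firstRow 1 + suc j ∷
      (if j <ᵇ K then firstRow 3 + j else firstRow 2 + 0) ∷ []
  colEntries (4 , j) = if j ≡ᵇ suc K then (firstRow 1 + j ∷ firstRow 2 + 0 ∷ []) else (firstRow 1 + j ∷ [])
  colEntries (5 , l) = firstRow 3 + l ∷ firstRow 4 + l ∷ firstRow 5 + l ∷ []
  colEntries (6 , l) = firstRow 3 + l ∷ firstRow 4 + l ∷ firstRow 5 + l ∷ []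
  colEntries _ = []

  entriesOfRow entriesOfCol : ℕ → List ℕ
  entriesOfRow r = rowEntries (locate rowBlocks r)
  entriesOfCol v = colEntries (locate colBlocks v)

  M : Matrix m n
  M r j = elem (toℕ j) (entriesOfRow (toℕ r))

  entriesOfRow-block : ∀ c i → i < size rowBlocks c → entriesOfRow (firstRow c + i) ≡ rowEntries (c , i)
  entriesOfRow-block c i lt = cong rowEntries (locate-offset rowBlocks c i lt)

  entriesOfCol-block : ∀ c i → i < size colBlocks c → entriesOfCol (firstCol c + i) ≡ colEntries (c , i)
  entriesOfCol-block c i lt = cong colEntries (locate-offset colBlocks c i lt)

  k≤K : k ≤ K
  k≤K = m≤m+n k _

  kk≤K : k + k ≤ K
  kk≤K = +-monoʳ-≤ k (m≤m+n k _)

  kkk≤K : k + (k + k) ≤ K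
  kkk≤K = +-monoʳ-≤ k (+-monoʳ-≤ k (≤-reflexive (sym (+-identityʳ k))))

  k+l<K : ∀ l → l < k → k + l < K
  k+l<K l lt = ≤-trans (+-monoʳ-< k lt) kk≤K

  k+k+l<K : ∀ l → l < k → k + (k + l) < K
  k+k+l<K l lt = ≤-trans (+-monoʳ-< k (+-monoʳ-< k lt)) kkk≤K

  <K⇒<S : ∀ {x} → x < K → x < S
  <K⇒<S lt = ≤-trans lt (≤-trans (n≤1+n _) (n≤1+n _))

  prevCol-0 : firstCol 3 + 0 ∸ 1 ≡ firstCol 2 + K-1
  prevCol-0 = cong (_∸ 1) (arith k0)
    where
    arith : ∀ k0 → let K = 3 * suc k0 in (K + (K + (K + 0))) + 0 ≡ suc ((K + (K + 0)) + (k0 + 2 * suc k0))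
    arith = solve-∀

  prevCol-suc : ∀ j → firstCol 3 + suc j ∸ 1 ≡ firstCol 3 + j
  prevCol-suc j = cong (_∸ 1) (+-suc (firstCol 3) j)

  firstRow3+k : ∀ l → firstRow 3 + (k + l) ≡ firstRow 4 + l
  firstRow3+k l = h k0 l
    where
    h : ∀ k0 l → let K = 3 * suc k0 ; S = suc (suc K) in
        (K + (S + (1 + 0))) + (suc k0 + l) ≡ (K + (S + (1 + (suc k0 + 0)))) + l
    h = solve-∀

  firstRow3+k+k : ∀ l → firstRow 3 + (k + (k + l)) ≡ firstRow 5 + l
  firstRow3+k+k l = h k0 l
    where
    h : ∀ k0 l → let K = 3 * suc k0 ; S = suc (suc K) in
        (K + (S + (1 + 0))) + (suc k0 + (suc k0 + l)) ≡ (K + (S + (1 + (suc k0 + (suc k0 + 0))))) + l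
    h = solve-∀

  D∈colEntries4 : ∀ j → firstRow 1 + j ∈ˡ colEntries (4 , j)
  D∈colEntries4 j with j ≡ᵇ suc K
  ... | true = here refl
  ... | false = here refl

  T∈colEntries3 : ∀ j → K ≤ j → firstRow 2 + 0 ∈ˡ colEntries (3 , j)
  T∈colEntries3 j le rewrite <ᵇ-false {j} {K} le = there (there (here refl))

  B∈colEntries3 : ∀ j → j < K → firstRow 3 + j ∈ˡ colEntries (3 , j)
  B∈colEntries3 j lt rewrite <ᵇ-true lt = there (there (here refl))

  T∈colEntries4 : firstRow 2 + 0 ∈ˡ colEntries (4 , suc K)
  T∈colEntries4 rewrite ≡ᵇ-true {suc K} refl = there (here refl)

  ∈entriesOfCol : ∀ x c' i' → i' < size colBlocks c' →
    x ∈ˡ colEntries (c' , i') → x ∈ˡ entriesOfCol (firstCol c' + i')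
  ∈entriesOfCol x c' i' lt mem = subst (x ∈ˡ_) (sym (entriesOfCol-block c' i' lt)) mem

  entriesOfRow⇒entriesOfCol : ∀ r → r < m → ∀ v → v ∈ˡ entriesOfRow r → r ∈ˡ entriesOfCol v
  entriesOfRow⇒entriesOfCol r rlt v vin with blockIndex rowBlocks r rlt
  ... | c , i , lt , refl = go c i lt v (subst (v ∈ˡ_) (entriesOfRow-block c i lt) vin)
    where
    go : ∀ c i → i < size rowBlocks c → ∀ v → v ∈ˡ rowEntries (c , i) → firstRow c + i ∈ˡ entriesOfCol v
    go 0 i lt v (here refl) = ∈entriesOfCol _ 0 i lt (here refl)
    go 0 i lt v (there (here refl)) = ∈entriesOfCol _ 1 i lt (here refl)
    go 0 i lt v (there (there (here refl))) = ∈entriesOfCol _ 2 i lt (here refl)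
    go 1 j lt v (here refl) = ∈entriesOfCol _ 3 j lt (here refl)
    go 1 j lt v (there (here refl)) = ∈entriesOfCol _ 4 j lt (D∈colEntries4 j)
    go 1 zero lt v (there (there (here refl))) = subst (λ z → firstRow 1 + 0 ∈ˡ entriesOfCol z)
        (sym prevCol-0) (∈entriesOfCol _ 2 K-1 (n<1+n K-1) (there (here refl)))
    go 1 (suc j) lt v (there (there (here refl))) = subst
        (λ z → firstRow 1 + suc j ∈ˡ entriesOfCol z) (sym (prevCol-suc j))
        (∈entriesOfCol _ 3 j (<-trans (n<1+n j) lt) (there (here refl)))
    go 2 zero lt v (here refl) = ∈entriesOfCol _ 3 (suc K) (n<1+n (suc K)) (T∈colEntries3 (suc K) (n≤1+n K))
    go 2 zero lt v (there (here refl)) = ∈entriesOfCol _ 4 (suc K) (n<1+n (suc K)) T∈colEntries4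
    go 2 zero lt v (there (there (here refl))) = subst (λ z → firstRow 2 + 0 ∈ˡ entriesOfCol z)
        (sym (prevCol-suc K)) (∈entriesOfCol _ 3 K (m<n⇒m<1+n (n<1+n K)) (T∈colEntries3 K ≤-refl))
    go 3 l lt v (here refl) = ∈entriesOfCol _ 3 l (<K⇒<S (≤-trans lt k≤K)) (B∈colEntries3 l (≤-trans lt k≤K))
    go 3 l lt v (there (here refl)) = ∈entriesOfCol _ 5 l lt (here refl)
    go 3 l lt v (there (there (here refl))) = ∈entriesOfCol _ 6 l lt (here refl)
    go 4 l lt v (here refl) = ∈entriesOfCol _ 3 (k + l) (<K⇒<S (k+l<K l lt))
        (subst (_∈ˡ colEntries (3 , k + l)) (firstRow3+k l) (B∈colEntries3 (k + l) (k+l<K l lt)))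
    go 4 l lt v (there (here refl)) = ∈entriesOfCol _ 5 l lt (there (here refl))
    go 4 l lt v (there (there (here refl))) = ∈entriesOfCol _ 6 l lt (there (here refl))
    go 5 l lt v (here refl) = ∈entriesOfCol _ 3 (k + (k + l)) (<K⇒<S (k+k+l<K l lt))
        (subst (_∈ˡ colEntries (3 , k + (k + l))) (firstRow3+k+k l)
        (B∈colEntries3 (k + (k + l)) (k+k+l<K l lt)))
    go 5 l lt v (there (here refl)) = ∈entriesOfCol _ 5 l lt (there (there (here refl)))
    go 5 l lt v (there (there (here refl))) = ∈entriesOfCol _ 6 l lt (there (there (here refl)))
    go 1 j lt v (there (there (there ())))
    go 2 (suc i) (s≤s ()) v _

  row : ℕ → Fin m
  row = toFin

  col : ℕ → Fin n
  col = toFin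

  blockCol : ℕ → ℕ → Fin n
  blockCol c i = col (firstCol c + i)

  toℕ-blockCol : ∀ c i → i < size colBlocks c → toℕ (blockCol c i) ≡ firstCol c + i
  toℕ-blockCol c i lt = toℕ-toFin (firstCol c + i) (offset+i<total colBlocks c i lt)

  toℕ-row : ∀ v → v < m → toℕ (row v) ≡ v
  toℕ-row v lt = toℕ-toFin v lt

  M⇒∈entriesOfRow : ∀ r j → M r j ≡ true → toℕ j ∈ˡ entriesOfRow (toℕ r)
  M⇒∈entriesOfRow r j e = elem⇒∈ (entriesOfRow (toℕ r)) e

  M⇒∈entriesOfCol : ∀ r j → M r j ≡ true → toℕ r ∈ˡ entriesOfCol (toℕ j)
  M⇒∈entriesOfCol r j e = entriesOfRow⇒entriesOfCol (toℕ r) (toℕ<n r) (toℕ j) (M⇒∈entriesOfRow r j e)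

  colEntries-length : ∀ p → length (colEntries p) ≤ 3
  colEntries-length (0 , i) = s≤s z≤n
  colEntries-length (1 , i) = s≤s z≤n
  colEntries-length (2 , i) = s≤s (s≤s z≤n)
  colEntries-length (3 , j) = ≤-refl
  colEntries-length (4 , j) with j ≡ᵇ suc K
  ... | true = s≤s (s≤s z≤n)
  ... | false = s≤s z≤n
  colEntries-length (5 , l) = ≤-refl
  colEntries-length (6 , l) = ≤-refl
  colEntries-length (suc (suc (suc (suc (suc (suc (suc c)))))) , i) = z≤n

  colWeight≤3 : ColWeightAtMost3 M
  colWeight≤3 j = ≤-trans (subst (weight (λ r → M r j) ≤_) (length-map row L)
    (weight-≤ (map row L) g)) (colEntries-length (locate colBlocks (toℕ j)))
    where
    L : List ℕ
    L = entriesOfCol (toℕ j)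
    g : ∀ {y} → M y j ≡ true → y ∈ˡ map row L
    g {y} e = subst (_∈ˡ map row L) (toFin-toℕ y) (∈-map⁺ row (M⇒∈entriesOfCol y j e))

  M-blockRow : ∀ (r : Fin m) c i → toℕ r ≡ firstRow c + i → i < size rowBlocks c →
    ∀ j → M r j ≡ elem (toℕ j) (rowEntries (c , i))
  M-blockRow r c i e lt j = cong (elem (toℕ j)) (trans (cong entriesOfRow e) (entriesOfRow-block c i lt))

  M-blockCol : ∀ (r : Fin m) c i → toℕ r ≡ firstRow c + i → i < size rowBlocks c →
    ∀ c' i' → i' < size colBlocks c' → (firstCol c' + i') ∈ˡ rowEntries (c , i) →
    M r (blockCol c' i') ≡ true
  M-blockCol r c i e lt c' i' lt' mem = trans (M-blockRow r c i e lt (blockCol c' i'))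
    (trans (cong (λ z → elem z (rowEntries (c , i))) (toℕ-blockCol c' i' lt')) (∈⇒elem _ mem))

  blockCol-≢ : ∀ c i c' i' → i < size colBlocks c → i' < size colBlocks c' →
    ¬ ((c ≡ c') × (i ≡ i')) → blockCol c i ≢ blockCol c' i'
  blockCol-≢ c i c' i' lt lt' ne e = ne
      (offset-injective colBlocks lt lt'
      (trans (sym (toℕ-blockCol c i lt)) (trans (cong toℕ e) (toℕ-blockCol c' i' lt'))))

  AllAtLeast : ℕ → List ℕ → Set
  AllAtLeast s L = ∀ x → x ∈ˡ L → s ≤ x

  -- The run choosing A₀, …, A_{K-1}, D₀, …, D_{K+1}

  stage : ℕ → State m n
  stage = run M row

  coveredAt : ℕ → Fin n → Bool
  coveredAt = isCovered M row

  T : ℕ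
  T = K + S

  chosen-stage : ∀ s → s ≤ m → ∀ r → lookup (chosen (stage s)) r ≡ (toℕ r <ᵇ s)
  chosen-stage zero _ r = lookup-replicate r outside
  chosen-stage (suc s) le r = trans (chosen-suc M row s r)
      (trans (cong (lookup (chosen (stage s)) r ∨_) eqpart)
      (trans (cong (_∨ (toℕ r ≡ᵇ s)) (chosen-stage s (≤-trans (n≤1+n s) le) r)) (<ᵇ-suc (toℕ r) s)))
    where
    eqpart : ⌊ r ≟ᶠ row s ⌋ ≡ (toℕ r ≡ᵇ s)
    eqpart with r ≟ᶠ row s
    ... | yes e = sym (≡ᵇ-true (trans (cong toℕ e) (toℕ-row s le)))
    ... | no ne = sym (≡ᵇ-false (λ e → ne (toℕ≡⇒≡toFin r e)))

  not-yet-covered : ∀ s j → s ≤ m → AllAtLeast s (entriesOfCol (toℕ j)) → coveredAt s j ≡ false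
  not-yet-covered s j le ag = isCovered-false M row s j f
    where
    f : ∀ s' → s' < s → M (row s') j ≡ false
    f s' lt = ¬-not (λ e → <⇒≱ lt (subst (s ≤_) (toℕ-row s' (≤-trans lt le))
        (ag _ (M⇒∈entriesOfCol (row s') j e))))

  already-covered : ∀ s j s' → s' < s → M (row s') j ≡ true → coveredAt s j ≡ true
  already-covered s j s' lt e = isCovered-true M row s j s' lt e

  weightAt : ℕ → Fin m → ℕ
  weightAt s r = weight (current (stage s) r)

  LiveEntry : ℕ → Fin m → ℕ × ℕ → Set
  LiveEntry s r (c , i) = (i < size colBlocks c) × (M r (blockCol c i) ≡ true) × AllAtLeast s
      (colEntries (c , i))

  colAt : ℕ × ℕ → Fin n
  colAt (c , i) = blockCol c i

  weight≥ : ∀ s r (ps : List (ℕ × ℕ)) → s ≤ m → Unique (map colAt ps) → All (LiveEntry s r) ps →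
      length ps ≤ weightAt s r
  weight≥ s r ps le d al = subst (_≤ weightAt s r) (length-map colAt ps) (weight-≥ d (g ps al))
    where
    g : ∀ ps → All (LiveEntry s r) ps → All (λ j → current (stage s) r j ≡ true) (map colAt ps)
    g [] [] = []
    g ((c , i) ∷ ps) ((lt , Mt , ag) ∷ al) =
      trans (current-run M row s r (blockCol c i))
        (cong₂ (λ u w → u ∧ not w) Mt (not-yet-covered s (blockCol c i) le
            (subst (λ z → AllAtLeast s (entriesOfCol z)) (sym (toℕ-blockCol c i lt))
            (subst (AllAtLeast s) (sym (entriesOfCol-block c i lt)) ag)))) ∷ g ps al

  weight≤ : ∀ s r (vs : List ℕ) → (∀ j → M r j ≡ true → coveredAt s j ≡ false → toℕ j ∈ˡ vs) →
      weightAt s r ≤ length vs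
  weight≤ s r vs h = subst (weightAt s r ≤_) (length-map col vs) (weight-≤ (map col vs) g)
    where
    ∧n : ∀ a b → a ∧ not b ≡ true → (a ≡ true) × (b ≡ false)
    ∧n true false _ = refl , refl
    g : ∀ {y} → current (stage s) r y ≡ true → y ∈ˡ map col vs
    g {y} e with ∧n (M r y) (coveredAt s y) (trans (sym (current-run M row s r y)) e)
    ... | a , b = subst (_∈ˡ map col vs) (toFin-toℕ y) (∈-map⁺ col (h y a b))

  firstRow1 : ∀ j → firstRow 1 + j ≡ K + j
  firstRow1 j = cong (_+ j) (+-identityʳ K)

  K≤firstRow : ∀ c x → K ≤ firstRow (suc c) + x
  K≤firstRow c x = ≤-trans (m≤m+n K _) (m≤m+n _ x)

  T≤firstRow : ∀ c x → T ≤ firstRow (suc (suc c)) + x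
  T≤firstRow c x = ≤-trans (≤-reflexive (cong (K +_) (sym (+-identityʳ S))))
    (≤-trans (+-monoʳ-≤ K (+-monoʳ-≤ S z≤n)) (m≤m+n _ x))

  T<m : T < m
  T<m = +-monoʳ-< K (m<m+n S (s≤s z≤n))

  K<T : K < T
  K<T = m<m+n K (s≤s z≤n)

  T-1 : ℕ
  T-1 = firstRow 1 + suc K

  T-1<T : T-1 < T
  T-1<T = ≤-reflexive (trans (cong suc (firstRow1 (suc K))) (sym (+-suc K (suc K))))

  firstRow2≡T : firstRow 2 + 0 ≡ T
  firstRow2≡T = trans (+-identityʳ _) (cong (K +_) (+-identityʳ S))

  ≤T⇒<m : ∀ {s} → s ≤ T → s < m
  ≤T⇒<m le = ≤-<-trans le T<m

  ge-col0 : ∀ s i → s ≤ i → AllAtLeast s (colEntries (0 , i))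
  ge-col0 s i le x (here refl) = le

  ge-col1 : ∀ s i → s ≤ i → AllAtLeast s (colEntries (1 , i))
  ge-col1 s i le x (here refl) = le

  ge-col2 : ∀ s i → s ≤ i → s ≤ K → AllAtLeast s (colEntries (2 , i))
  ge-col2 s i le _ x (here refl) = le
  ge-col2 s i le lK x (there (here refl)) = ≤-trans lK (K≤firstRow 0 0)

  ge-col3 : ∀ s j → s ≤ firstRow 1 + j → s ≤ T → AllAtLeast s (colEntries (3 , j))
  ge-col3 s j le _ x (here refl) = le
  ge-col3 s j le _ x (there (here refl)) = ≤-trans le (+-monoʳ-≤ (firstRow 1) (n≤1+n j))
  ge-col3 s j le lT x (there (there (here refl))) with j <ᵇ K
  ... | true = ≤-trans lT (T≤firstRow 1 j)
  ... | false = ≤-trans lT (T≤firstRow 0 0)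

  ge-col4 : ∀ s j → s ≤ firstRow 1 + j → s ≤ T → AllAtLeast s (colEntries (4 , j))
  ge-col4 s j le lT x mem with j ≡ᵇ suc K
  ge-col4 s j le lT x (here refl) | true = le
  ge-col4 s j le lT x (there (here refl)) | true = ≤-trans lT (T≤firstRow 0 0)
  ge-col4 s j le lT x (here refl) | false = le

  ge-col5 : ∀ s l → s ≤ T → AllAtLeast s (colEntries (5 , l))
  ge-col5 s l lT x (here refl) = ≤-trans lT (T≤firstRow 1 l)
  ge-col5 s l lT x (there (here refl)) = ≤-trans lT (T≤firstRow 2 l)
  ge-col5 s l lT x (there (there (here refl))) = ≤-trans lT (T≤firstRow 3 l)

  ge-col6 : ∀ s l → s ≤ T → AllAtLeast s (colEntries (6 , l))
  ge-col6 s l lT x (here refl) = ≤-trans lT (T≤firstRow 1 l)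
  ge-col6 s l lT x (there (here refl)) = ≤-trans lT (T≤firstRow 2 l)
  ge-col6 s l lT x (there (there (here refl))) = ≤-trans lT (T≤firstRow 3 l)

  K-1<K : K-1 < K
  K-1<K = n<1+n K-1

  1+K<S : suc K < S
  1+K<S = n<1+n (suc K)

  K<S : K < S
  K<S = <-trans (n<1+n K) 1+K<S

  <k⇒<K : ∀ {l} → l < k → l < K
  <k⇒<K lt = ≤-trans lt k≤K

  block≢ : ∀ {c i c' i' : ℕ} → ¬ (c ≡ c') → ¬ ((c ≡ c') × (i ≡ i'))
  block≢ ne (e , _) = ne e

  offset≢ : ∀ {c i c' i' : ℕ} → ¬ (i ≡ i') → ¬ ((c ≡ c') × (i ≡ i'))
  offset≢ ne (_ , e) = ne e

  weight≥3 : ∀ s r p1 p2 p3 → s ≤ m →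
    colAt p1 ≢ colAt p2 → colAt p1 ≢ colAt p3 → colAt p2 ≢ colAt p3 →
    LiveEntry s r p1 → LiveEntry s r p2 → LiveEntry s r p3 → 3 ≤ weightAt s r
  weight≥3 s r p1 p2 p3 le n12 n13 n23 o1 o2 o3 =
    weight≥ s r (p1 ∷ p2 ∷ p3 ∷ []) le ((n12 ∷ n13 ∷ []) ∷ (n23 ∷ []) ∷ [] ∷ []) (o1 ∷ o2 ∷ o3 ∷ [])

  weight≥2 : ∀ s r p1 p2 → s ≤ m → colAt p1 ≢ colAt p2 →
    LiveEntry s r p1 → LiveEntry s r p2 → 2 ≤ weightAt s r
  weight≥2 s r p1 p2 le n12 o1 o2 = weight≥ s r (p1 ∷ p2 ∷ []) le ((n12 ∷ []) ∷ [] ∷ []) (o1 ∷ o2 ∷ [])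

  weight≥3-B : ∀ s → s ≤ K → ∀ (r : Fin m) c l q → toℕ r ≡ firstRow c + l →
    l < size rowBlocks c → l < k → q < K →
    rowEntries (c , l) ≡ (firstCol 3 + q ∷ firstCol 5 + l ∷ firstCol 6 + l ∷ []) → 3 ≤ weightAt s r
  weight≥3-B s sK r c l q e lt l<k q<K entries = weight≥3 s r (3 , q) (5 , l) (6 , l) sm
    (blockCol-≢ 3 q 5 l q<S l<k (block≢ λ ())) (blockCol-≢ 3 q 6 l q<S l<k (block≢ λ ()))
    (blockCol-≢ 5 l 6 l l<k l<k (block≢ λ ()))
    (q<S , M-blockCol r c l e lt 3 q q<S (entry (here refl)) , ge-col3 s q (≤-trans sK (K≤firstRow 0 q)) sT)
    (l<k , M-blockCol r c l e lt 5 l l<k (entry (there (here refl))) , ge-col5 s l sT)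
    (l<k , M-blockCol r c l e lt 6 l l<k (entry (there (there (here refl)))) , ge-col6 s l sT)
    where
    sT : s ≤ T
    sT = ≤-trans sK (<⇒≤ K<T)
    sm : s ≤ m
    sm = ≤-trans sT (<⇒≤ T<m)
    q<S : q < S
    q<S = <K⇒<S q<K
    entry : ∀ {x} → x ∈ˡ (firstCol 3 + q ∷ firstCol 5 + l ∷ firstCol 6 + l ∷ []) → x ∈ˡ rowEntries (c , l)
    entry = subst (_ ∈ˡ_) (sym entries)

  weight≥3-phaseA : ∀ s → s < K → ∀ (r : Fin m) → s ≤ toℕ r → 3 ≤ weightAt s r
  weight≥3-phaseA s sK r le = let (c , i , lt , e) = blockIndex rowBlocks (toℕ r) (toℕ<n r) in go c i lt e
    where
    sm : s ≤ m
    sm = ≤-trans (<⇒≤ sK) (<⇒≤ (<-trans K<T T<m))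
    sK' : s ≤ K
    sK' = <⇒≤ sK
    sT : s ≤ T
    sT = ≤-trans sK' (<⇒≤ K<T)
    go : ∀ c i → i < size rowBlocks c → toℕ r ≡ firstRow c + i → 3 ≤ weightAt s r
    go 0 i lt e = weight≥3 s r (0 , i) (1 , i) (2 , i) sm
      (blockCol-≢ 0 i 1 i lt lt (block≢ λ ())) (blockCol-≢ 0 i 2 i lt lt (block≢ λ ()))
          (blockCol-≢ 1 i 2 i lt lt (block≢ λ ()))
      (lt , M-blockCol r 0 i e lt 0 i lt (here refl) , ge-col0 s i (subst (s ≤_) e le))
      (lt , M-blockCol r 0 i e lt 1 i lt (there (here refl)) , ge-col1 s i (subst (s ≤_) e le))
      (lt , M-blockCol r 0 i e lt 2 i lt (there (there (here refl))) , ge-col2 s i (subst (s ≤_) e le) sK')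
    go 1 zero lt e = weight≥3 s r (3 , 0) (4 , 0) (2 , K-1) sm
      (blockCol-≢ 3 0 4 0 lt lt (block≢ λ ())) (blockCol-≢ 3 0 2 K-1 lt K-1<K (block≢ λ ()))
          (blockCol-≢ 4 0 2 K-1 lt K-1<K (block≢ λ ()))
      (lt , M-blockCol r 1 0 e lt 3 0 lt (here refl) , ge-col3 s 0 (≤-trans sK' (K≤firstRow 0 0)) sT)
      (lt , M-blockCol r 1 0 e lt 4 0 lt (there (here refl)) , ge-col4 s 0 (≤-trans sK' (K≤firstRow 0 0)) sT)
      (K-1<K , M-blockCol r 1 0 e lt 2 K-1 K-1<K (there (there (here (sym prevCol-0)))) , ge-col2 s
          K-1 (≤-pred sK) sK')
    go 1 (suc j) lt e = weight≥3 s r (3 , suc j) (4 , suc j) (3 , j) sm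
      (blockCol-≢ 3 (suc j) 4 (suc j) lt lt (block≢ λ ())) (blockCol-≢ 3 (suc j) 3 j lt jl (offset≢ 1+n≢n))
      (blockCol-≢ 4 (suc j) 3 j lt jl (block≢ λ ()))
      (lt , M-blockCol r 1 (suc j) e lt 3 (suc j) lt (here refl) , ge-col3 s (suc j)
          (≤-trans sK' (K≤firstRow 0 _)) sT)
      (lt , M-blockCol r 1 (suc j) e lt 4 (suc j) lt (there (here refl)) , ge-col4 s (suc j)
          (≤-trans sK' (K≤firstRow 0 _)) sT)
      (jl , M-blockCol r 1 (suc j) e lt 3 j jl (there (there (here (sym (prevCol-suc j))))) ,
          ge-col3 s j (≤-trans sK' (K≤firstRow 0 _)) sT)
      where
      jl : j < S
      jl = <-trans (n<1+n j) lt
    go 2 zero lt e = weight≥3 s r (3 , suc K) (4 , suc K) (3 , K) sm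
      (blockCol-≢ 3 (suc K) 4 (suc K) 1+K<S 1+K<S (block≢ λ ()))
          (blockCol-≢ 3 (suc K) 3 K 1+K<S K<S (offset≢ 1+n≢n))
      (blockCol-≢ 4 (suc K) 3 K 1+K<S K<S (block≢ λ ()))
      (1+K<S , M-blockCol r 2 0 e lt 3 (suc K) 1+K<S (here refl) , ge-col3 s (suc K)
          (≤-trans sK' (K≤firstRow 0 _)) sT)
      (1+K<S , M-blockCol r 2 0 e lt 4 (suc K) 1+K<S (there (here refl)) , ge-col4 s (suc K)
          (≤-trans sK' (K≤firstRow 0 _)) sT)
      (K<S , M-blockCol r 2 0 e lt 3 K K<S (there (there (here (sym (prevCol-suc K))))) , ge-col3 s
          K (≤-trans sK' (K≤firstRow 0 _)) sT)
    go 2 (suc i) (s≤s ()) e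
    go 3 l lt e = weight≥3-B s sK' r 3 l l e lt lt (<k⇒<K lt) refl
    go 4 l lt e = weight≥3-B s sK' r 4 l (k + l) e lt lt (k+l<K l lt) refl
    go 5 l lt e = weight≥3-B s sK' r 5 l (k + (k + l)) e lt lt (k+k+l<K l lt) refl
    go (suc (suc (suc (suc (suc (suc c)))))) i () e

  weight≥2-phaseD : ∀ s → K ≤ s → s < T → ∀ (r : Fin m) → s ≤ toℕ r → 2 ≤ weightAt s r
  weight≥2-phaseD s Ks sT' r le = let (c , i , lt , e) = blockIndex rowBlocks (toℕ r) (toℕ<n r) in go c i lt e
    where
    sm : s ≤ m
    sm = <⇒≤ (<-trans sT' T<m)
    sT : s ≤ T
    sT = <⇒≤ sT'
    sT1 : s ≤ firstRow 1 + suc K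
    sT1 = ≤-pred (≤-trans sT' (≤-reflexive (sym T-1<T')))
      where
      T-1<T' : suc (firstRow 1 + suc K) ≡ T
      T-1<T' = trans (cong suc (firstRow1 (suc K))) (sym (+-suc K (suc K)))
    go : ∀ c i → i < size rowBlocks c → toℕ r ≡ firstRow c + i → 2 ≤ weightAt s r
    go 0 i lt e = ⊥-elim (<⇒≱ lt (≤-trans Ks (subst (s ≤_) e le)))
    go 1 j lt e = weight≥2 s r (3 , j) (4 , j) sm (blockCol-≢ 3 j 4 j lt lt (block≢ λ ()))
      (lt , M-blockCol r 1 j e lt 3 j lt (here refl) , ge-col3 s j (subst (s ≤_) e le) sT)
      (lt , M-blockCol r 1 j e lt 4 j lt (there (here refl)) , ge-col4 s j (subst (s ≤_) e le) sT)
    go 2 zero lt e = weight≥2 s r (3 , suc K) (4 , suc K) sm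
        (blockCol-≢ 3 (suc K) 4 (suc K) 1+K<S 1+K<S (block≢ λ ()))
      (1+K<S , M-blockCol r 2 0 e lt 3 (suc K) 1+K<S (here refl) , ge-col3 s (suc K) sT1 sT)
      (1+K<S , M-blockCol r 2 0 e lt 4 (suc K) 1+K<S (there (here refl)) , ge-col4 s (suc K) sT1 sT)
    go 2 (suc i) (s≤s ()) e
    go 3 l lt e = weight≥2 s r (5 , l) (6 , l) sm (blockCol-≢ 5 l 6 l lt lt (block≢ λ ()))
      (lt , M-blockCol r 3 l e lt 5 l lt (there (here refl)) , ge-col5 s l sT)
      (lt , M-blockCol r 3 l e lt 6 l lt (there (there (here refl))) , ge-col6 s l sT)
    go 4 l lt e = weight≥2 s r (5 , l) (6 , l) sm (blockCol-≢ 5 l 6 l lt lt (block≢ λ ()))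
      (lt , M-blockCol r 4 l e lt 5 l lt (there (here refl)) , ge-col5 s l sT)
      (lt , M-blockCol r 4 l e lt 6 l lt (there (there (here refl))) , ge-col6 s l sT)
    go 5 l lt e = weight≥2 s r (5 , l) (6 , l) sm (blockCol-≢ 5 l 6 l lt lt (block≢ λ ()))
      (lt , M-blockCol r 5 l e lt 5 l lt (there (here refl)) , ge-col5 s l sT)
      (lt , M-blockCol r 5 l e lt 6 l lt (there (there (here refl))) , ge-col6 s l sT)
    go (suc (suc (suc (suc (suc (suc c)))))) i () e

  length-entriesOfA : ∀ s → s < K → length (entriesOfRow s) ≡ 3
  length-entriesOfA s sK rewrite entriesOfRow-block 0 s sK = refl

  weightA≤3 : ∀ s → s < K → weightAt s (row s) ≤ 3
  weightA≤3 s sK = subst (weightAt s (row s) ≤_) (length-entriesOfA s sK) (weight≤ s (row s) (entriesOfRow s) h)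
    where
    sm : s < m
    sm = <-trans sK (<-trans K<T T<m)
    h : ∀ j → M (row s) j ≡ true → coveredAt s j ≡ false → toℕ j ∈ˡ entriesOfRow s
    h j e _ = subst (λ z → toℕ j ∈ˡ entriesOfRow z) (toℕ-row s sm) (M⇒∈entriesOfRow (row s) j e)

  toℕ-rowD : ∀ d → d < S → toℕ (row (K + d)) ≡ firstRow 1 + d
  toℕ-rowD d lt = trans (toℕ-row (K + d) (<-trans (+-monoʳ-< K lt) T<m)) (sym (firstRow1 d))

  true≢false : true ≢ false
  true≢false ()

  prevCol-covered : ∀ d → d < S → ∀ j → toℕ j ≡ firstCol 3 + d ∸ 1 → coveredAt (K + d) j ≡ true
  prevCol-covered zero lt j q = already-covered (K + 0) j K-1
      (≤-trans (n<1+n K-1) (≤-reflexive (sym (+-identityʳ K))))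
              (trans (M-blockRow (row K-1) 0 K-1 (toℕ-row K-1 (<-trans K-1<K (<-trans K<T T<m))) K-1<K j)
                     (∈⇒elem (rowEntries (0 , K-1)) (there (there (here (trans q prevCol-0))))))
  prevCol-covered (suc j') lt j q = already-covered (K + suc j') j (K + j') (+-monoʳ-< K (n<1+n j'))
              (trans (M-blockRow (row (K + j')) 1 j' (toℕ-rowD j' (<-trans (n<1+n j') lt))
                  (<-trans (n<1+n j') lt) j)
                     (∈⇒elem (chainRow j') (here (trans q (prevCol-suc j')))))

  weightD≤2 : ∀ d → d < S → weightAt (K + d) (row (K + d)) ≤ 2
  weightD≤2 d lt = weight≤ (K + d) (row (K + d)) (firstCol 3 + d ∷ firstCol 4 + d ∷ []) h
    where
    s : ℕ
    s = K + d
    h : ∀ j → M (row s) j ≡ true → coveredAt s j ≡ false → toℕ j ∈ˡ (firstCol 3 + d ∷ firstCol 4 + d ∷ [])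
    h j e c = kmem (elem⇒∈ (chainRow d) (trans (sym (M-blockRow (row s) 1 d (toℕ-rowD d lt) lt j)) e))
      where
      kmem : toℕ j ∈ˡ chainRow d → toℕ j ∈ˡ (firstCol 3 + d ∷ firstCol 4 + d ∷ [])
      kmem (here q) = here q
      kmem (there (here q)) = there (here q)
      kmem (there (there (here q))) = ⊥-elim (true≢false (trans (sym (prevCol-covered d lt j q)) c))

  ge-blockCol : ∀ s c i → i < size colBlocks c →
    AllAtLeast s (colEntries (c , i)) → AllAtLeast s (entriesOfCol (toℕ (blockCol c i)))
  ge-blockCol s c i lt ag = subst (λ z → AllAtLeast s (entriesOfCol z)) (sym (toℕ-blockCol c i lt))
      (subst (AllAtLeast s) (sym (entriesOfCol-block c i lt)) ag)

  support-nonempty : ∀ s c (x : Fin n) → M c x ≡ true → coveredAt s x ≡ false →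
    Nonempty (rowSupport (current (stage s)) c)
  support-nonempty s c x Mt unc = x , lookup⇒∈ (trans (lookup∘tabulate (current (stage s) c) x)
    (trans (current-run M row s c x) (cong₂ (λ u w → u ∧ not w) Mt unc)))

  chosen≢⊤ : ∀ s → s ≤ T → chosen (stage s) ≢ ⊤
  chosen≢⊤ s le e = lookup≡false⇒∉
      (trans (chosen-stage s (<⇒≤ (≤T⇒<m le)) (row T)) (trans (cong (_<ᵇ s) (toℕ-row T T<m)) (<ᵇ-false le)))
    (subst (row T ∈_) (sym e) ∈⊤)

  covered≢⊤ : ∀ s → s ≤ T → covered (stage s) ≢ ⊤
  covered≢⊤ s le e = lookup≡false⇒∉
      (not-yet-covered s (blockCol 6 0) (<⇒≤ (≤T⇒<m le)) (ge-blockCol s 6 0 (s≤s z≤n) (ge-col6 s 0 le)))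
    (subst (blockCol 6 0 ∈_) (sym e) ∈⊤)

  row∉chosen : ∀ s → s < m → row s ∉ chosen (stage s)
  row∉chosen s lt = lookup≡false⇒∉
      (trans (chosen-stage s (<⇒≤ lt) (row s))
      (trans (cong (_<ᵇ s) (toℕ-row s lt)) (<ᵇ-false {s} {s} ≤-refl)))

  unchosen⇒≥ : ∀ s → s ≤ m → ∀ c' → c' ∉ chosen (stage s) → s ≤ toℕ c'
  unchosen⇒≥ s le c' h = <ᵇ-false⁻ (trans (sym (chosen-stage s le c')) (∉⇒lookup≡false h))

  continuingChoice : ∀ s w → s ≤ T → weightAt s (row s) ≤ w → (∀ (r : Fin m) → s ≤ toℕ r → w ≤ weightAt s r) →
    ∀ x → M (row s) x ≡ true → coveredAt s x ≡ false → ContinuingChoice (stage s) (row s)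
  continuingChoice s w sT ub lb x Mx unc = record
    { chosen≢⊤  = chosen≢⊤ s sT
    ; covered≢⊤ = covered≢⊤ s sT
    ; lightest  = row∉chosen s sm , λ c' h → ≤-trans ub (lb c' (unchosen⇒≥ s (<⇒≤ sm) c' h))
    ; nonempty  = support-nonempty s (row s) x Mx unc
    }
    where
    sm : s < m
    sm = ≤T⇒<m sT

  choice-A : ∀ s → s < K → ContinuingChoice (stage s) (row s)
  choice-A s sK = continuingChoice s 3 sT (weightA≤3 s sK) (weight≥3-phaseA s sK)
    (blockCol 0 s) (M-blockCol (row s) 0 s (toℕ-row s sm) sK 0 s sK (here refl))
    (not-yet-covered s (blockCol 0 s) (<⇒≤ sm) (ge-blockCol s 0 s sK (ge-col0 s s ≤-refl)))
    where
    sT : s ≤ T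
    sT = <⇒≤ (<-trans sK K<T)
    sm : s < m
    sm = <-trans sK (<-trans K<T T<m)

  choice-D : ∀ d → d < S → ContinuingChoice (stage (K + d)) (row (K + d))
  choice-D d lt = continuingChoice s 2 sT (weightD≤2 d lt) (weight≥2-phaseD s (m≤m+n K d) sT')
    (blockCol 3 d) (M-blockCol (row s) 1 d (toℕ-rowD d lt) lt 3 d lt (here refl))
    (not-yet-covered s (blockCol 3 d) (<⇒≤ sm)
        (ge-blockCol s 3 d lt (ge-col3 s d (≤-reflexive (sym (firstRow1 d))) sT)))
    where
    s : ℕ
    s = K + d
    sT' : s < T
    sT' = +-monoʳ-< K lt
    sT : s ≤ T
    sT = <⇒≤ sT'
    sm : s < m
    sm = <-trans sT' T<m

  choices : ∀ s → s < T → ContinuingChoice (stage s) (row s)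
  choices s lt = go (s <? K)
    where
    go : Dec (s < K) → ContinuingChoice (stage s) (row s)
    go (yes sK) = choice-A s sK
    go (no nsK) = subst (λ z → ContinuingChoice (stage z) (row z)) (m+[n∸m]≡n (≮⇒≥ nsK))
      (choice-D (s ∸ K) (+-cancelˡ-< K (s ∸ K) S (subst (_< T) (sym (m+[n∸m]≡n (≮⇒≥ nsK))) lt)))

  -- The halting step and the output of STRIP

  rowT : Fin m
  rowT = row T

  lastD : Fin m
  lastD = row T-1

  toℕ-rowT : toℕ rowT ≡ firstRow 2 + 0
  toℕ-rowT = trans (toℕ-row T T<m) (sym firstRow2≡T)

  toℕ-lastD : toℕ lastD ≡ firstRow 1 + suc K
  toℕ-lastD = toℕ-row T-1 (<-trans T-1<T T<m)

  rowT≗lastD : ∀ j → M rowT j ≡ M lastD j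
  rowT≗lastD j = trans (M-blockRow rowT 2 0 toℕ-rowT (s≤s z≤n) j)
      (sym (M-blockRow lastD 1 (suc K) toℕ-lastD 1+K<S j))

  rowT-cleared : ∀ j → current (stage T) rowT j ≡ false
  rowT-cleared j = trans (current-run M row T rowT j) (go (M rowT j) refl)
    where
    go : ∀ b → M rowT j ≡ b → M rowT j ∧ not (coveredAt T j) ≡ false
    go true e = trans (cong₂ (λ u w → u ∧ not w) e
        (already-covered T j T-1 T-1<T (trans (sym (rowT≗lastD j)) e))) refl
    go false e = cong (λ u → u ∧ not (coveredAt T j)) e

  C-halt : Subset m
  C-halt = chosen (stage T) ∪ ⁅ rowT ⁆

  V-halt : Subset n
  V-halt = covered (stage T) ∪ rowSupport (current (stage T)) rowT

  finder-halts : ∀ CA VA → StripRun M C-halt V-halt CA VA → ¬ EmptySub CA VA → Finder M M ⊥ ⊥ CA VA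
  finder-halts CA VA sr ne = finder-after T choices
    (halt rowT (chosen≢⊤ T ≤-refl) (covered≢⊤ T ≤-refl) li emp sr ne)
    where
    li : Lightest (current (stage T)) (chosen (stage T)) rowT
    li = row∉chosen T T<m , λ c' _ → ≤-trans
        (weight-≤ {f = current (stage T) rowT} []
        (λ {j} e → ⊥-elim (true≢false (trans (sym e) (rowT-cleared j))))) z≤n
    emp : Empty (rowSupport (current (stage T)) rowT)
    emp (x , xin) = true≢false (trans (sym (∈-tabulate⁻ {f = current (stage T) rowT} xin)) (rowT-cleared x))

  T≡1+T-1 : T ≡ suc T-1
  T≡1+T-1 = sym (trans (cong suc (firstRow1 (suc K))) (sym (+-suc K (suc K))))

  -- STRIP peels A_t at (1,t) and then D_j at (4,j) for j ≤ K.
  stripBlock : ℕ → ℕ × ℕ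
  stripBlock t = if t <ᵇ K then (1 , t) else (4 , t ∸ K)

  stripCol : ℕ → Fin n
  stripCol t = colAt (stripBlock t)

  stripBlock-A : ∀ t → t < K → stripBlock t ≡ (1 , t)
  stripBlock-A t lt rewrite <ᵇ-true lt = refl

  stripBlock-D : ∀ t → K ≤ t → stripBlock t ≡ (4 , t ∸ K)
  stripBlock-D t le rewrite <ᵇ-false {t} {K} le = refl

  D-offset<1+K : ∀ t → K ≤ t → t < T-1 → t ∸ K < suc K
  D-offset<1+K t le lt = +-cancelˡ-< K (t ∸ K) (suc K)
    (subst (_< K + suc K) (sym (m+[n∸m]≡n le)) (subst (t <_) (firstRow1 (suc K)) lt))

  firstRow1-offset : ∀ t → K ≤ t → t ≡ firstRow 1 + (t ∸ K)
  firstRow1-offset t le = trans (sym (m+[n∸m]≡n le)) (sym (firstRow1 (t ∸ K)))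

  D-offset<S : ∀ t → K ≤ t → t < T-1 → t ∸ K < S
  D-offset<S t le lt = <-trans (D-offset<1+K t le lt) 1+K<S

  T-1<m : T-1 < m
  T-1<m = <-trans T-1<T T<m

  StripCase : ℕ → Set
  StripCase t = ((stripBlock t ≡ (1 , t)) × t < K) ⊎
                  (Σ ℕ λ j → (stripBlock t ≡ (4 , j)) × j < suc K × t ≡ K + j)

  stripBlock-cases : ∀ t → t < T-1 → StripCase t
  stripBlock-cases t lt with t <? K
  ... | yes p = inj₁ (stripBlock-A t p , p)
  ... | no p = inj₂ (t ∸ K , stripBlock-D t (≮⇒≥ p) , D-offset<1+K t (≮⇒≥ p) lt , sym (m+[n∸m]≡n (≮⇒≥ p)))

  M-strip : ∀ t → t < T-1 → M (row t) (stripCol t) ≡ true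
  M-strip t lt = go (stripBlock-cases t lt)
    where
    P : ℕ × ℕ → Set
    P q = M (row t) (colAt q) ≡ true
    go : StripCase t → P (stripBlock t)
    go (inj₁ (e , p)) = subst P (sym e)
        (M-blockCol (row t) 0 t (toℕ-row t (<-trans lt T-1<m)) p 1 t p (there (here refl)))
    go (inj₂ (j , e , jl , te)) = subst P (sym e)
        (M-blockCol (row t) 1 j (trans (toℕ-row t (<-trans lt T-1<m)) (trans te (sym (firstRow1 j))))
           (<-trans jl 1+K<S) 4 j (<-trans jl 1+K<S) (there (here refl)))

  colEntries4-single : ∀ j → j ≢ suc K → colEntries (4 , j) ≡ (firstRow 1 + j ∷ [])
  colEntries4-single j ne rewrite ≡ᵇ-false {j} {suc K} ne = refl

  entriesOfStripCol : ∀ t c i → stripBlock t ≡ (c , i) → i < size colBlocks c →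
    ∀ x → x ∈ˡ entriesOfCol (toℕ (stripCol t)) → x ∈ˡ colEntries (c , i)
  entriesOfStripCol t c i ce lt x mem = subst (x ∈ˡ_)
      (trans (cong entriesOfCol (trans (cong (λ p → toℕ (colAt p)) ce) (toℕ-blockCol c i lt)))
      (entriesOfCol-block c i lt)) mem

  stripCol-unique-A : ∀ t x → x ∈ˡ colEntries (1 , t) → x ≡ t
  stripCol-unique-A t x (here q) = q

  stripCol-unique-D : ∀ t x → K ≤ t → t ∸ K ≢ suc K → x ∈ˡ colEntries (4 , t ∸ K) → x ≡ t
  stripCol-unique-D t x le ne mem with subst (x ∈ˡ_) (colEntries4-single (t ∸ K) ne) mem
  ... | here q = trans q (sym (firstRow1-offset t le))

  stripCol-unique : ∀ t → t < T-1 → ∀ x → x ∈ˡ entriesOfCol (toℕ (stripCol t)) → x ≡ t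
  stripCol-unique t lt x mem = go (t <? K)
    where
    go : Dec (t < K) → x ≡ t
    go (yes p) = stripCol-unique-A t x (entriesOfStripCol t 1 t (stripBlock-A t p) p x mem)
    go (no p) = stripCol-unique-D t x (≮⇒≥ p) (λ e → <-irrefl e (D-offset<1+K t (≮⇒≥ p) lt))
        (entriesOfStripCol t 4 (t ∸ K) (stripBlock-D t (≮⇒≥ p)) (D-offset<S t (≮⇒≥ p) lt) x mem)

  colAt-≢ : ∀ {a b : ℕ × ℕ} c i c' i' → a ≡ (c , i) → b ≡ (c' , i') →
    blockCol c i ≢ blockCol c' i' → colAt a ≢ colAt b
  colAt-≢ c i c' i' refl refl ne = ne

  stripCol-injective : ∀ t t' → t' < t → t < T-1 → stripCol t ≢ stripCol t'
  stripCol-injective t t' lt' lt = go (stripBlock-cases t lt) (stripBlock-cases t' (<-trans lt' lt))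
    where
    go : StripCase t → StripCase t' → stripCol t ≢ stripCol t'
    go (inj₁ (e , p)) (inj₁ (e' , p')) = colAt-≢ 1 t 1 t' e e'
        (blockCol-≢ 1 t 1 t' p p' (offset≢ (λ q → <-irrefl (sym q) lt')))
    go (inj₁ (e , p)) (inj₂ (j' , e' , jl' , _)) = colAt-≢ 1 t 4 j' e e'
        (blockCol-≢ 1 t 4 j' p (<-trans jl' 1+K<S) (block≢ λ ()))
    go (inj₂ (j , e , jl , _)) (inj₁ (e' , p')) = colAt-≢ 4 j 1 t' e e'
        (blockCol-≢ 4 j 1 t' (<-trans jl 1+K<S) p' (block≢ λ ()))
    go (inj₂ (j , e , jl , te)) (inj₂ (j' , e' , jl' , te')) = colAt-≢ 4 j 4 j' e e'
      (blockCol-≢ 4 j 4 j' (<-trans jl 1+K<S) (<-trans jl' 1+K<S) (offset≢ (λ q → <-irrefl (cong (K +_) (sym q))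
         (subst₂ _<_ te' te lt'))))

  stripCol-avoids : ∀ c i → i < size colBlocks c → c ≢ 1 → (c ≢ 4 ⊎ i ≡ suc K) → ∀ t → t < T-1 →
      blockCol c i ≢ stripCol t
  stripCol-avoids c i li n1 n4 t lt = go (stripBlock-cases t lt) n4
    where
    go : StripCase t → (c ≢ 4 ⊎ i ≡ suc K) → blockCol c i ≢ stripCol t
    go (inj₁ (e , p)) _ = λ q → blockCol-≢ c i 1 t li p (block≢ n1) (trans q (cong colAt e))
    go (inj₂ (j , e , jl , _)) (inj₁ n4') = λ q → blockCol-≢ c i 4 j li (<-trans jl 1+K<S)
        (block≢ n4') (trans q (cong colAt e))
    go (inj₂ (j , e , jl , _)) (inj₂ refl) = λ q → blockCol-≢ c (suc K) 4 j li (<-trans jl 1+K<S)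
        (offset≢ (λ q → <-irrefl (sym q) jl)) (trans q (cong colAt e))

  ∈V-halt : ∀ x → coveredAt T x ≡ true → x ∈ V-halt
  ∈V-halt x e = x∈p∪q⁺ (inj₁ (lookup⇒∈ e))

  ∈C-halt : ∀ r → toℕ r < T → r ∈ C-halt
  ∈C-halt r lt = x∈p∪q⁺ (inj₁ (lookup⇒∈ (trans (chosen-stage T (<⇒≤ T<m) r) (<ᵇ-true lt))))

  rowT∈C-halt : rowT ∈ C-halt
  rowT∈C-halt = x∈p∪q⁺ (inj₂ (x∈⁅x⁆ rowT))

  CA : Subset m
  CA = removeFirst C-halt row T-1

  VA : Subset n
  VA = removeFirst V-halt stripCol T-1

  strip-pivots : PivotSequence M C-halt V-halt row stripCol T-1
  strip-pivots t lt = record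
    { col∈V  = removeFirst⁺ t (∈V-halt (stripCol t)
        (already-covered T (stripCol t) t tT (M-strip t lt))) (λ t' lt' → stripCol-injective t t' lt' lt)
    ; row∈C  = removeFirst⁺ t (∈C-halt (row t) (subst (_< T) (sym (toℕ-row t tm)) tT))
                 (λ t' lt' → toFin-≢ tm (<-trans lt' tm) (λ q → <-irrefl (sym q) lt'))
    ; entry  = M-strip t lt
    ; unique = λ {r'} _ e → toℕ≡⇒≡toFin r' (stripCol-unique t lt (toℕ r') (M⇒∈entriesOfCol r' (stripCol t) e))
    }
    where
    tT : t < T
    tT = <-trans lt T-1<T
    tm : t < m
    tm = <-trans tT T<m

  CA-rows : ∀ {r} → r ∈ CA → r ≡ lastD ⊎ r ≡ rowT
  CA-rows {r} h with x∈p∪q⁻ (chosen (stage T)) ⁅ rowT ⁆ (removeFirst⊆ T-1 h)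
  ... | inj₂ r∈⁅rowT⁆ = inj₂ (x∈⁅y⁆⇒x≡y rowT r∈⁅rowT⁆)
  ... | inj₁ r∈chosen = inj₁ (toℕ≡⇒≡toFin r (≤-antisym (≤-pred (subst (toℕ r <_) T≡1+T-1 lt)) ge))
    where
    lt : toℕ r < T
    lt = <ᵇ-true⁻ (trans (sym (chosen-stage T (<⇒≤ T<m) r)) ([]=⇒lookup r∈chosen))
    ge : T-1 ≤ toℕ r
    ge with toℕ r <? T-1
    ... | yes p = ⊥-elim (removeFirst-removed T-1 h (toℕ r) p (sym (toFin-toℕ r)))
    ... | no p = ≮⇒≥ p

  rowT∈CA : rowT ∈ CA
  rowT∈CA = removeFirst⁺ T-1 rowT∈C-halt
      (λ t' lt' → toFin-≢ T<m (<-trans (<-trans lt' T-1<T) T<m) (λ q → <-irrefl (sym q) (<-trans lt' T-1<T)))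

  lastD∈CA : lastD ∈ CA
  lastD∈CA = removeFirst⁺ T-1 (∈C-halt lastD (subst (_< T) (sym toℕ-lastD) T-1<T))
      (λ t' lt' → toFin-≢ T-1<m (<-trans lt' T-1<m) (λ q → <-irrefl (sym q) lt'))

  lastD≢rowT : lastD ≢ rowT
  lastD≢rowT = toFin-≢ T-1<m T<m (λ q → <-irrefl q T-1<T)

  strip-stops : ∀ x → x ∈ VA → colWeightIn M CA x ≢ 1
  strip-stops x _ = twin-rows⇒colWeightIn≢1 {M = M} lastD≢rowT lastD∈CA rowT∈CA CA-rows
      (λ x → sym (rowT≗lastD x)) x

  col3-last : Fin n
  col3-last = blockCol 3 (suc K)

  col3-last∈VA : col3-last ∈ VA
  col3-last∈VA = removeFirst⁺ T-1
      (∈V-halt col3-last (already-covered T col3-last T-1 T-1<T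
      (M-blockCol lastD 1 (suc K) toℕ-lastD 1+K<S 3 (suc K) 1+K<S (here refl))))
      (stripCol-avoids 3 (suc K) 1+K<S (λ ()) (inj₁ (λ ())))

  col4-last : Fin n
  col4-last = blockCol 4 (suc K)

  M-lastD-col4-last : M lastD col4-last ≡ true
  M-lastD-col4-last = M-blockCol lastD 1 (suc K) toℕ-lastD 1+K<S 4 (suc K) 1+K<S (there (here refl))

  col4-last∈VA : col4-last ∈ VA
  col4-last∈VA = removeFirst⁺ T-1
      (∈V-halt col4-last (already-covered T col4-last T-1 T-1<T M-lastD-col4-last))
      (stripCol-avoids 4 (suc K) 1+K<S (λ ()) (inj₂ refl))

  A-nonempty : ¬ EmptySub CA VA
  A-nonempty (inj₁ e) = e (rowT , rowT∈CA)
  A-nonempty (inj₂ e) = e (col3-last , col3-last∈VA)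

  strip-run : StripRun M C-halt V-halt CA VA
  strip-run = strip-peel* T-1 strip-pivots (done strip-stops)

  finder-outputs-A : Finder M M ⊥ ⊥ CA VA
  finder-outputs-A = finder-halts CA VA strip-run A-nonempty

  dA : ℕ
  dA = ∣ VA - col4-last ∣

  kerA : KerDim M CA VA dA
  kerA = ker-duplicate-row {M = M} lastD∈CA lastD≢rowT (λ j _ → rowT≗lastD j)
           (ker-peel pivot (ker-without-rows {M = M} no-rows (VA - col4-last)))
    where
    uniq : ∀ {r'} → r' ∈ CA - rowT → M r' col4-last ≡ true → r' ≡ lastD
    uniq {r'} h _ with CA-rows (x∈p-y⇒x∈p h)
    ... | inj₁ q = q
    ... | inj₂ q = ⊥-elim (x∈p-y⇒x≢y h q)
    pivot : Pivot M (CA - rowT) VA lastD col4-last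
    pivot = record
      { col∈V  = col4-last∈VA
      ; row∈C  = x∈p∧x≢y⇒x∈p-y lastD∈CA lastD≢rowT
      ; entry  = M-lastD-col4-last
      ; unique = uniq
      }
    no-rows : ∀ r → r ∉ (CA - rowT) - lastD
    no-rows r h with CA-rows (x∈p-y⇒x∈p (x∈p-y⇒x∈p h))
    ... | inj₁ q = x∈p-y⇒x≢y h q
    ... | inj₂ q = x∈p-y⇒x≢y (x∈p-y⇒x∈p h) q

  lookup-V-halt : ∀ j → lookup V-halt j ≡ coveredAt T j
  lookup-V-halt j = trans (lookup-∪ (covered (stage T)) (rowSupport (current (stage T)) rowT) j)
    (trans (cong (coveredAt T j ∨_)
        (trans (lookup∘tabulate (current (stage T) rowT) j) (rowT-cleared j))) (∨-identityʳ (coveredAt T j)))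

  coveredAt-halt : ∀ j → coveredAt T j ≡ (toℕ j <ᵇ firstCol 5)
  coveredAt-halt j = let (c , i , lt , e) = blockIndex colBlocks (toℕ j) (toℕ<n j) in go c i lt e
    where
    below : ∀ c i → c < 5 → i < size colBlocks c → toℕ j ≡ firstCol c + i → (toℕ j <ᵇ firstCol 5) ≡ true
    below c i c5 lt e = <ᵇ-true (subst (_< firstCol 5) (sym e)
        (≤-trans (+-monoʳ-< (firstCol c) lt)
        (offset-mono colBlocks c 5 c5 (s≤s (s≤s (s≤s (s≤s (s≤s z≤n))))))))
    above5 : ∀ i → toℕ j ≡ firstCol 5 + i → (toℕ j <ᵇ firstCol 5) ≡ false
    above5 i e = <ᵇ-false (subst (firstCol 5 ≤_) (sym e) (m≤m+n (firstCol 5) i))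
    above6 : ∀ i → toℕ j ≡ firstCol 6 + i → (toℕ j <ᵇ firstCol 5) ≡ false
    above6 i e = <ᵇ-false (subst (firstCol 5 ≤_) (sym e)
        (≤-trans (≤-trans (m≤m+n (firstCol 5) k)
        (offset-mono colBlocks 5 6 (n<1+n 5) (s≤s (s≤s (s≤s (s≤s (s≤s (s≤s z≤n))))))))
        (m≤m+n (firstCol 6) i)))
    byA : ∀ i → i < K → toℕ j ∈ˡ rowEntries (0 , i) → coveredAt T j ≡ true
    byA i lt mem = already-covered T j i (<-trans lt K<T)
      (trans (M-blockRow (row i) 0 i (toℕ-row i (<-trans lt (<-trans K<T T<m))) lt j)
             (∈⇒elem (rowEntries (0 , i)) mem))
    byD : ∀ i → i < S → toℕ j ∈ˡ chainRow i → coveredAt T j ≡ true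
    byD i lt mem = already-covered T j (K + i) (+-monoʳ-< K lt)
      (trans (M-blockRow (row (K + i)) 1 i (toℕ-rowD i lt) lt j) (∈⇒elem (chainRow i) mem))
    untouched : ∀ c i → i < size colBlocks c → toℕ j ≡ firstCol c + i →
      AllAtLeast T (colEntries (c , i)) → coveredAt T j ≡ false
    untouched c i lt e ge = not-yet-covered T j (<⇒≤ T<m)
      (subst (λ z → AllAtLeast T (entriesOfCol z)) (sym e)
          (subst (AllAtLeast T) (sym (entriesOfCol-block c i lt)) ge))
    go : ∀ c i → i < size colBlocks c → toℕ j ≡ firstCol c + i → coveredAt T j ≡ (toℕ j <ᵇ firstCol 5)
    go 0 i lt e = trans (byA i lt (here e)) (sym (below 0 i (s≤s z≤n) lt e))
    go 1 i lt e = trans (byA i lt (there (here e))) (sym (below 1 i (s≤s (s≤s z≤n)) lt e))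
    go 2 i lt e = trans (byA i lt (there (there (here e)))) (sym (below 2 i (s≤s (s≤s (s≤s z≤n))) lt e))
    go 3 i lt e = trans (byD i lt (here e)) (sym (below 3 i (s≤s (s≤s (s≤s (s≤s z≤n)))) lt e))
    go 4 i lt e = trans (byD i lt (there (here e))) (sym (below 4 i (s≤s (s≤s (s≤s (s≤s (s≤s z≤n))))) lt e))
    go 5 i lt e = trans (untouched 5 i lt e (ge-col5 T i ≤-refl)) (sym (above5 i e))
    go 6 i lt e = trans (untouched 6 i lt e (ge-col6 T i ≤-refl)) (sym (above6 i e))
    go (suc (suc (suc (suc (suc (suc (suc c))))))) i () e

  firstCol5≤n : firstCol 5 ≤ n
  firstCol5≤n = ≤-trans (m≤m+n (firstCol 5) (size colBlocks 5))
      (offset-mono colBlocks 5 7 (s≤s (s≤s (s≤s (s≤s (s≤s (s≤s z≤n)))))) ≤-refl)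

  ∣V-halt∣ : ∣ V-halt ∣ ≡ firstCol 5
  ∣V-halt∣ = ∣initialSegment∣ V-halt (firstCol 5) firstCol5≤n
      (λ j → trans (lookup-V-halt j) (coveredAt-halt j))

  dA-count : suc dA + T-1 ≡ firstCol 5
  dA-count = trans (cong (_+ T-1) (sym (∣p∣≡1+∣p-x∣ col4-last∈VA)))
    (trans (∣removeFirst∣ T-1 (λ t' lt → Pivot.col∈V (strip-pivots t' lt))) ∣V-halt∣)

  -- The kernel of M

  TM : ℕ
  TM = T + K

  m≡1+TM : m ≡ suc TM
  m≡1+TM = h k0
    where
    h : ∀ k0 → let K = 3 * suc k0 ; S = suc (suc K) in
        K + (S + (1 + (suc k0 + (suc k0 + (suc k0 + 0))))) ≡ suc ((K + S) + K)
    h = solve-∀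

  firstRow3 : ∀ l → suc (T + l) ≡ firstRow 3 + l
  firstRow3 l = h K S l
    where
    h : ∀ K S l → suc ((K + S) + l) ≡ (K + (S + (1 + 0))) + l
    h = solve-∀

  -- With T removed (it duplicates D_{K+1}), the t-th remaining row is peeled at column
  -- elimCol t: A_t at (1,t), D_j at (4,j), B at (3,l); elimIdx skips the index of T.
  elimIdx : ℕ → ℕ
  elimIdx t = if t <ᵇ T then t else suc t

  elimRow : ℕ → Fin m
  elimRow t = row (elimIdx t)

  elimBlock : ℕ → ℕ × ℕ
  elimBlock t = if t <ᵇ K then (1 , t) else (if t <ᵇ T then (4 , t ∸ K) else (3 , t ∸ T))

  elimCol : ℕ → Fin n
  elimCol t = colAt (elimBlock t)

  data ElimStep (t : ℕ) : Set where
    phaseA : t < K → elimIdx t ≡ t → elimBlock t ≡ (1 , t) → ElimStep t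
    phaseD : ∀ j → t ≡ K + j → j < S → elimIdx t ≡ t → elimBlock t ≡ (4 , j) → ElimStep t
    phaseB : ∀ l → t ≡ T + l → l < K → elimIdx t ≡ suc t → elimBlock t ≡ (3 , l) → ElimStep t

  elimIdx-<T : ∀ t → t < T → elimIdx t ≡ t
  elimIdx-<T t p rewrite <ᵇ-true p = refl

  elimIdx-≥T : ∀ t → T ≤ t → elimIdx t ≡ suc t
  elimIdx-≥T t p rewrite <ᵇ-false {t} {T} p = refl

  elimBlock-A : ∀ t → t < K → elimBlock t ≡ (1 , t)
  elimBlock-A t p rewrite <ᵇ-true p = refl

  elimBlock-D : ∀ t → K ≤ t → t < T → elimBlock t ≡ (4 , t ∸ K)
  elimBlock-D t p q rewrite <ᵇ-false {t} {K} p | <ᵇ-true q = refl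

  elimBlock-B : ∀ t → K ≤ t → T ≤ t → elimBlock t ≡ (3 , t ∸ T)
  elimBlock-B t p q rewrite <ᵇ-false {t} {K} p | <ᵇ-false {t} {T} q = refl

  elimStep : ∀ t → t < TM → ElimStep t
  elimStep t lt = g1 (t <? K)
    where
    g2 : ¬ (t < K) → Dec (t < T) → ElimStep t
    g1 : Dec (t < K) → ElimStep t
    g1 (yes p) = phaseA p (elimIdx-<T t (<-trans p K<T)) (elimBlock-A t p)
    g1 (no p) = g2 p (t <? T)
    g2 p (yes q) = phaseD (t ∸ K) (sym (m+[n∸m]≡n (≮⇒≥ p)))
        (+-cancelˡ-< K (t ∸ K) S (subst (_< T) (sym (m+[n∸m]≡n (≮⇒≥ p))) q))
                  (elimIdx-<T t q) (elimBlock-D t (≮⇒≥ p) q)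
    g2 p (no q) = phaseB (t ∸ T) (sym (m+[n∸m]≡n (≮⇒≥ q)))
        (+-cancelˡ-< T (t ∸ T) K (subst (_< TM) (sym (m+[n∸m]≡n (≮⇒≥ q))) lt))
                  (elimIdx-≥T t (≮⇒≥ q)) (elimBlock-B t (≮⇒≥ p) (≮⇒≥ q))

  elimIdx<m : ∀ t → t < TM → elimIdx t < m
  elimIdx<m t lt = g (elimStep t lt)
    where
    g : ElimStep t → elimIdx t < m
    g (phaseA _ e _) = subst (_< m) (sym e) (<-trans lt (subst (TM <_) (sym m≡1+TM) (n<1+n TM)))
    g (phaseD _ _ _ e _) = subst (_< m) (sym e) (<-trans lt (subst (TM <_) (sym m≡1+TM) (n<1+n TM)))
    g (phaseB _ _ _ e _) = subst (_< m) (sym e) (subst (suc t <_) (sym m≡1+TM) (s≤s lt))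

  M-B-col3 : ∀ (r : Fin m) l → l < K → toℕ r ≡ firstRow 3 + l → M r (blockCol 3 l) ≡ true
  M-B-col3 r l lt e = g1 (l <? k)
    where
    g2 : ¬ (l < k) → Dec (l ∸ k < k) → M r (blockCol 3 l) ≡ true
    g1 : Dec (l < k) → M r (blockCol 3 l) ≡ true
    g1 (yes p) = M-blockCol r 3 l e p 3 l (<K⇒<S lt) (here refl)
    g1 (no p) = g2 p (l ∸ k <? k)
    g2 p (yes q) = M-blockCol r 4 (l ∸ k)
        (trans e (trans (cong (firstRow 3 +_) (sym l≡)) (firstRow3+k (l ∸ k)))) q 3 l (<K⇒<S lt)
                  (here (cong (firstCol 3 +_) (sym l≡)))
      where
      l≡ : k + (l ∸ k) ≡ l
      l≡ = m+[n∸m]≡n (≮⇒≥ p)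
    g2 p (no q) = M-blockCol r 5 (l ∸ k ∸ k)
        (trans e (trans (cong (firstRow 3 +_) (sym l≡)) (firstRow3+k+k (l ∸ k ∸ k)))) q' 3 l (<K⇒<S lt)
                  (here (cong (firstCol 3 +_) (sym l≡)))
      where
      l≡ : k + (k + (l ∸ k ∸ k)) ≡ l
      l≡ = trans (cong (k +_) (m+[n∸m]≡n (≮⇒≥ q))) (m+[n∸m]≡n (≮⇒≥ p))
      q' : l ∸ k ∸ k < k
      q' = +-cancelˡ-< k _ k (+-cancelˡ-< k _ (k + k) (subst (_< k + (k + k)) (sym l≡)
             (subst (l <_) (cong (λ z → k + (k + z)) (+-identityʳ k)) lt)))

  M-elim : ∀ t → t < TM → M (elimRow t) (elimCol t) ≡ true
  M-elim t lt = g (elimStep t lt)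
    where
    P : ℕ → ℕ × ℕ → Set
    P a q = M (row a) (colAt q) ≡ true
    g : ElimStep t → P (elimIdx t) (elimBlock t)
    g (phaseA p e e') = subst₂ P (sym e) (sym e')
        (M-blockCol (row t) 0 t (toℕ-row t (<-trans p (<-trans K<T T<m))) p 1 t p (there (here refl)))
    g (phaseD j te jl e e') = subst₂ P (sym e) (sym e')
        (M-blockCol (row t) 1 j (trans (toℕ-row t
        (subst (_< m) (sym te) (<-trans (+-monoʳ-< K jl) T<m))) (trans te (sym (firstRow1 j)))) jl 4
        j jl (there (here refl)))
    g (phaseB l te ll e e') = subst₂ P (sym e) (sym e')
        (M-B-col3 (row (suc t)) l ll (trans (toℕ-row (suc t) (subst (_< m) e (elimIdx<m t lt)))
        (trans (cong suc te) (firstRow3 l))))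

  C-noT : Subset m
  C-noT = ⊤ - rowT

  elimIdx≤1+t : ∀ t → elimIdx t ≤ suc t
  elimIdx≤1+t t with t <ᵇ T
  ... | true = n≤1+n t
  ... | false = ≤-refl

  elimIdx-mono : ∀ t t' → t' < t → t < TM → elimIdx t' < elimIdx t
  elimIdx-mono t t' lt' lt = g (t <? T)
    where
    g : Dec (t < T) → elimIdx t' < elimIdx t
    g (yes p) = subst₂ _<_ (sym (elimIdx-<T t' (<-trans lt' p))) (sym (elimIdx-<T t p)) lt'
    g (no p) = subst (elimIdx t' <_) (sym (elimIdx-≥T t (≮⇒≥ p))) (s≤s (≤-trans (elimIdx≤1+t t') lt'))

  elimIdx≢T : ∀ t → t < TM → elimIdx t ≢ T
  elimIdx≢T t lt = g (elimStep t lt)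
    where
    g : ElimStep t → elimIdx t ≢ T
    g (phaseA p e _) = λ q → <-irrefl (trans (sym e) q) (<-trans p K<T)
    g (phaseD j te jl e _) = λ q → <-irrefl (trans (sym e) q) (subst (_< T) (sym te) (+-monoʳ-< K jl))
    g (phaseB l te ll e _) = λ q → <-irrefl (sym (trans (sym e) q)) (s≤s (subst (T ≤_) (sym te) (m≤m+n T l)))

  elimRow∈ : ∀ t → t < TM → elimRow t ∈ removeFirst C-noT elimRow t
  elimRow∈ t lt = removeFirst⁺ t (x∈p∧x≢y⇒x∈p-y (∈⊤)
      (toFin-≢ (elimIdx<m t lt) T<m (elimIdx≢T t lt)))
      (λ t' lt' → toFin-≢ (elimIdx<m t lt) (elimIdx<m t' (<-trans lt' lt))
      (λ q → <-irrefl (sym q) (elimIdx-mono t t' lt' lt)))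

  elimCol-injective : ∀ t t' → t < TM → t' < TM → t ≢ t' → elimCol t ≢ elimCol t'
  elimCol-injective t t' lt lt' ne = g (elimStep t lt) (elimStep t' lt')
    where
    g : ElimStep t → ElimStep t' → elimCol t ≢ elimCol t'
    g (phaseA p _ e) (phaseA p' _ e') = colAt-≢ 1 t 1 t' e e' (blockCol-≢ 1 t 1 t' p p' (offset≢ ne))
    g (phaseA p _ e) (phaseD j' _ jl' _ e') = colAt-≢ 1 t 4 j' e e' (blockCol-≢ 1 t 4 j' p jl' (block≢ λ ()))
    g (phaseA p _ e) (phaseB l' _ ll' _ e') = colAt-≢ 1 t 3 l' e e'
        (blockCol-≢ 1 t 3 l' p (<K⇒<S ll') (block≢ λ ()))
    g (phaseD j _ jl _ e) (phaseA p' _ e') = colAt-≢ 4 j 1 t' e e' (blockCol-≢ 4 j 1 t' jl p' (block≢ λ ()))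
    g (phaseD j te jl _ e) (phaseD j' te' jl' _ e') = colAt-≢ 4 j 4 j' e e'
        (blockCol-≢ 4 j 4 j' jl jl' (offset≢ (λ q → ne (trans te (trans (cong (K +_) q) (sym te'))))))
    g (phaseD j _ jl _ e) (phaseB l' _ ll' _ e') = colAt-≢ 4 j 3 l' e e'
        (blockCol-≢ 4 j 3 l' jl (<K⇒<S ll') (block≢ λ ()))
    g (phaseB l _ ll _ e) (phaseA p' _ e') = colAt-≢ 3 l 1 t' e e'
        (blockCol-≢ 3 l 1 t' (<K⇒<S ll) p' (block≢ λ ()))
    g (phaseB l _ ll _ e) (phaseD j' _ jl' _ e') = colAt-≢ 3 l 4 j' e e'
        (blockCol-≢ 3 l 4 j' (<K⇒<S ll) jl' (block≢ λ ()))
    g (phaseB l te ll _ e) (phaseB l' te' ll' _ e') = colAt-≢ 3 l 3 l' e e'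
        (blockCol-≢ 3 l 3 l' (<K⇒<S ll) (<K⇒<S ll')
        (offset≢ (λ q → ne (trans te (trans (cong (T +_) q) (sym te'))))))

  elimCol∈ : ∀ t → t < TM → elimCol t ∈ removeFirst ⊤ elimCol t
  elimCol∈ t lt = removeFirst⁺ t (∈⊤)
      (λ t' lt' → elimCol-injective t t' lt (<-trans lt' lt) (λ q → <-irrefl (sym q) lt'))

  eliminated-earlier : ∀ t r' → r' ∈ removeFirst C-noT elimRow t → ∀ v → v < T → v < t → toℕ r' ≢ v
  eliminated-earlier t r' h v vT vt e = removeFirst-removed t h v vt
      (trans (toℕ≡⇒≡toFin r' e) (cong row (sym (elimIdx-<T v vT))))

  entriesOfElimCol : ∀ t c i → elimBlock t ≡ (c , i) → i < size colBlocks c →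
    ∀ x → x ∈ˡ entriesOfCol (toℕ (elimCol t)) → x ∈ˡ colEntries (c , i)
  entriesOfElimCol t c i ce lt x mem = subst (x ∈ˡ_)
      (trans (cong entriesOfCol (trans (cong (λ p → toℕ (colAt p)) ce) (toℕ-blockCol c i lt)))
      (entriesOfCol-block c i lt)) mem

  colEntries3-B : ∀ l → l < K →
    colEntries (3 , l) ≡ (firstRow 1 + l ∷ firstRow 1 + suc l ∷ firstRow 3 + l ∷ [])
  colEntries3-B l lt rewrite <ᵇ-true lt = refl

  elim-unique-A : ∀ t r' → toℕ r' ∈ˡ colEntries (1 , t) → elimIdx t ≡ t → r' ≡ elimRow t
  elim-unique-A t r' (here q) rve = trans (toℕ≡⇒≡toFin r' q) (cong row (sym rve))

  colEntries4-last : colEntries (4 , suc K) ≡ (firstRow 1 + suc K ∷ firstRow 2 + 0 ∷ [])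
  colEntries4-last rewrite ≡ᵇ-true {suc K} refl = refl

  elim-unique-D : ∀ t j r' → t ≡ K + j → r' ∈ removeFirst C-noT elimRow t →
    toℕ r' ∈ˡ colEntries (4 , j) → elimIdx t ≡ t → r' ≡ elimRow t
  elim-unique-D t j r' te h mem rve = g (j ℕ.≟ suc K)
    where
    g : Dec (j ≡ suc K) → r' ≡ elimRow t
    g1 : toℕ r' ∈ˡ (firstRow 1 + j ∷ []) → r' ≡ elimRow t
    g1 (here q) = trans (toℕ≡⇒≡toFin r' (trans q (trans (firstRow1 j) (sym te)))) (cong row (sym rve))
    g (no ne) = g1 (subst (toℕ r' ∈ˡ_) (colEntries4-single j ne) mem)
    g (yes refl) = g2 (subst (toℕ r' ∈ˡ_) colEntries4-last mem)
      where
      g2 : toℕ r' ∈ˡ (firstRow 1 + suc K ∷ firstRow 2 + 0 ∷ []) → r' ≡ elimRow t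
      g2 (here q) = trans (toℕ≡⇒≡toFin r' (trans q (trans (firstRow1 (suc K)) (sym te)))) (cong row (sym rve))
      g2 (there (here q)) = ⊥-elim (x∈p-y⇒x≢y (removeFirst⊆ t h) (toℕ≡⇒≡toFin r' (trans q firstRow2≡T)))

  elim-unique-B : ∀ t l r' → t ≡ T + l → l < K → r' ∈ removeFirst C-noT elimRow t →
    toℕ r' ∈ˡ (firstRow 1 + l ∷ firstRow 1 + suc l ∷ firstRow 3 + l ∷ []) →
    elimIdx t ≡ suc t → r' ≡ elimRow t
  elim-unique-B t l r' te ll h (here q) rve = ⊥-elim
      (eliminated-earlier t r' h (K + l) v1 (≤-trans v1 (subst (T ≤_) (sym te) (m≤m+n T l)))
      (trans q (firstRow1 l)))
    where
    v1 : K + l < T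
    v1 = +-monoʳ-< K (<-trans ll K<S)
  elim-unique-B t l r' te ll h (there (here q)) rve = ⊥-elim
      (eliminated-earlier t r' h (K + suc l) v2 (≤-trans v2 (subst (T ≤_) (sym te) (m≤m+n T l)))
      (trans q (firstRow1 (suc l))))
    where
    v2 : K + suc l < T
    v2 = +-monoʳ-< K (≤-trans (s≤s ll) (n≤1+n (suc K)))
  elim-unique-B t l r' te ll h (there (there (here q))) rve = trans
      (toℕ≡⇒≡toFin r' (trans q (trans (sym (firstRow3 l)) (cong suc (sym te))))) (cong row (sym rve))

  elim-unique : ∀ t → t < TM → ∀ r' → r' ∈ removeFirst C-noT elimRow t → M r' (elimCol t) ≡ true →
      r' ≡ elimRow t
  elim-unique t lt r' h e = g (elimStep t lt)
    where
    g : ElimStep t → r' ≡ elimRow t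
    g (phaseA p rve ce) = elim-unique-A t r'
        (entriesOfElimCol t 1 t ce p (toℕ r') (M⇒∈entriesOfCol r' (elimCol t) e)) rve
    g (phaseD j te jl rve ce) = elim-unique-D t j r' te h
        (entriesOfElimCol t 4 j ce jl (toℕ r') (M⇒∈entriesOfCol r' (elimCol t) e)) rve
    g (phaseB l te ll rve ce) = elim-unique-B t l r' te ll h
        (subst (toℕ r' ∈ˡ_) (colEntries3-B l ll)
        (entriesOfElimCol t 3 l ce (<K⇒<S ll) (toℕ r') (M⇒∈entriesOfCol r' (elimCol t) e))) rve

  elim-pivots : PivotSequence M C-noT ⊤ elimRow elimCol TM
  elim-pivots t lt = record { col∈V = elimCol∈ t lt ; row∈C = elimRow∈ t lt ; entry = M-elim t lt ;
      unique = λ {r'} → elim-unique t lt r' }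

  no-rows-left′ : ∀ r v → toℕ r ≡ v → v < m → r ∉ removeFirst C-noT elimRow TM
  no-rows-left′ r v e vm h = g1 (v <? T)
    where
    g3 : ∀ v → toℕ r ≡ v → v < m → ¬ (v < T) → ¬ (v ≡ T) → Empty.⊥
    g3 zero e vm p q = p (≤-trans (s≤s z≤n) (<⇒≤ K<T))
    g3 (suc t) e vm p q = removeFirst-removed TM h t tTM
        (trans (toℕ≡⇒≡toFin r e) (cong row (sym (elimIdx-≥T t tT))))
      where
      tT : T ≤ t
      tT = ≤-pred (≤∧≢⇒< (≮⇒≥ p) (λ z → q (sym z)))
      tTM : t < TM
      tTM = ≤-pred (subst (suc t <_) m≡1+TM vm)
    g2 : ¬ (v < T) → Dec (v ≡ T) → Empty.⊥
    g2 p (yes q) = x∈p-y⇒x≢y (removeFirst⊆ TM h) (toℕ≡⇒≡toFin r (trans e q))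
    g2 p (no q) = g3 v e vm p q
    g1 : Dec (v < T) → Empty.⊥
    g1 (yes p) = eliminated-earlier TM r h v p (<-trans p (m<m+n T (s≤s z≤n))) e
    g1 (no p) = g2 p (v ℕ.≟ T)

  no-rows-left : ∀ r → r ∉ removeFirst C-noT elimRow TM
  no-rows-left r = no-rows-left′ r (toℕ r) refl (toℕ<n r)

  dM : ℕ
  dM = ∣ removeFirst ⊤ elimCol TM ∣

  kerM : KerDim M ⊤ ⊤ dM
  kerM = ker-duplicate-row {M = M} ∈⊤ lastD≢rowT (λ j _ → rowT≗lastD j)
    (ker-peel* TM elim-pivots (ker-without-rows {M = M} no-rows-left (removeFirst ⊤ elimCol TM)))

  dM-count : dM + TM ≡ n
  dM-count = trans (∣removeFirst∣ TM (λ t' lt → elimCol∈ t' lt)) (∣⊤∣≡n n)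

  n≡17k+4 : n ≡ 17 * k + 4
  n≡17k+4 = arith k0
    where
    arith : ∀ k0 → let k = suc k0 ; K = 3 * k ; S = suc (suc K) in
            K + (K + (K + (S + (S + (k + (k + 0)))))) ≡ 17 * k + 4
    arith = solve-∀

  dM≡8k+2 : dM ≡ 8 * k + 2
  dM≡8k+2 = +-cancelʳ-≡ TM dM (8 * k + 2) (trans dM-count (trans n≡17k+4 (arith k0)))
    where
    arith : ∀ k0 → let k = suc k0 ; K = 3 * k in 17 * k + 4 ≡ (8 * k + 2) + ((K + suc (suc K)) + K)
    arith = solve-∀

  dA≡9k+2 : dA ≡ 9 * k + 2
  dA≡9k+2 = suc-injective (+-cancelʳ-≡ T-1 (suc dA) (suc (9 * k + 2)) (trans dA-count (arith k0)))
    where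
    arith : ∀ k0 → let k = suc k0 ; K = 3 * k ; S = suc (suc K) in
            K + (K + (K + (S + (S + 0)))) ≡ suc (9 * k + 2) + ((K + 0) + suc K)
    arith = solve-∀

  kerM-bound : 2 * dM ≤ n + 4
  kerM-bound = subst₂ (λ d n → 2 * d ≤ n + 4) (sym dM≡8k+2) (sym n≡17k+4)
    (subst (2 * (8 * k + 2) ≤_) (arith k) (m≤m+n (2 * (8 * k + 2)) (k + 4)))
    where
    arith : ∀ k → 2 * (8 * k + 2) + (k + 4) ≡ 17 * k + 4 + 4
    arith = solve-∀

  kerA-bound : 50 * n + 2 * 1 * n ≤ 2 * 50 * dA
  kerA-bound = subst₂ (λ n d → 50 * n + 2 * 1 * n ≤ 2 * 50 * d) (sym n≡17k+4) (sym dA≡9k+2)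
    (subst (50 * n′ + 2 * 1 * n′ ≤_) (arith k0) (m≤m+n (50 * n′ + 2 * 1 * n′) (16 * k0 + 8)))
    where
    n′ : ℕ
    n′ = 17 * k + 4
    arith : ∀ k0 → let n′ = 17 * suc k0 + 4 in 50 * n′ + 2 * 1 * n′ + (16 * k0 + 8) ≡ 2 * 50 *
        (9 * suc k0 + 2)
    arith = solve-∀

  k0≤n : k0 ≤ n
  k0≤n = ≤-trans (n≤1+n k0) (≤-trans k≤K (m≤m+n K _))

theorem4p1 : ∃ λ (p : ℕ) → ∃ λ (q : ℕ) → 1 ≤ p × 1 ≤ q ×
    (∀ (N : ℕ) → ∃ λ (n : ℕ) → N ≤ n ×
    ∃ λ (m : ℕ) → Σ (Matrix m n) λ M → ColWeightAtMost3 M ×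
    ∃ λ (CA : Subset m) → ∃ λ (VA : Subset n) →
    Finder M M ⊥ ⊥ CA VA ×
    (∃ λ (d : ℕ) → KerDim M ⊤ ⊤ d × 2 * d ≤ n + 4) ×
    (∃ λ (d : ℕ) → KerDim M CA VA d × q * n + 2 * p * n ≤ 2 * q * d))
theorem4p1 = 1 , 50 , s≤s z≤n , s≤s z≤n , λ N → let open Construction N in
  n , k0≤n , m , M , colWeight≤3 , CA , VA , finder-outputs-A ,
  (dM , kerM , kerM-bound) , (dA , kerA , kerA-bound)
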